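{- Let $G$ be a 2-vertex connected graph on $n\ge 5$ vertices. If $k(G)\prec k(H_{n,1,2})$, then $W(G)<W(H_{n,1,2})$. Similarly, if $k(G)\prec k(H_{n,2,2})$, then $W(G)<W(H_{n,2,2})$.
   Context: All graphs are finite and simple. For a connected graph $G$, $d_G(u,v)$ is the distance between $u$ and $v$, and the Wiener index is $W(G)=\sum_{\{u,v\}\subseteq V(G)} d_G(u,v)$ (sum over unordered pairs of distinct vertices). For integers $p,q$ with $1\le p\le q\le n-p-q+1$ and $q>1$, $H_{n,p,q}$ is the graph on $n$ vertices consisting of three internally disjoint paths between the same two end-vertices, of lengths $p$, $q$ and $n-p-q+1$ (a path of length 1 is an edge). For a connected graph $G$ on $n$ vertices and $v\in V(G)$, the distance vector $\omega_G(v)$ is the $(n-1)$-dimensional vector with $\omega_G(v)_i=|\{x\in V(G): d_G(v,x)=i\}|$. Let $k(v)$ be the smallest index $i$ with $\omega_G(v)_i>2$; if no such index exists, $k(v)=\lfloor n/2\rfloor$. Let $k(G)=(k_1(G),\dots,k_n(G))$ be the sequence of the values $k(v)$, $v\in V(G)$, listed in non-decreasing order. For two graphs $G,G'$ on $n$ vertices, $k(G)\preceq k(G')$ means $k_i(G)\le k_i(G')$ for all $i\in\{1,\dots,n\}$, and $k(G)\prec k(G')$ means $k(G)\preceq k(G')$ and additionally $k_j(G)<k_j(G')$ for some $j$. -}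

module Defs where

open import Data.Bool using (Bool; true; false; _∧_; _∨_; not; T; if_then_else_)
open import Data.Nat using (ℕ; zero; suc; _+_; _∸_; _≤_; _<_; _≡ᵇ_; _<ᵇ_; _/_)
open import Data.Nat.Properties using (≤-decTotalOrder)
open import Data.Fin using (Fin; toℕ; _≟_)
open import Data.List using (List; []; _∷_; _++_; map; length; allFin; filter; zip; concatMap)
open import Data.Bool.ListAction using (any)
open import Data.Nat.ListAction using (sum)
open import Data.List.Relation.Binary.Pointwise using (Pointwise)
open import Data.List.Relation.Unary.Any using (Any)
open import Data.Product using (_×_; _,_; proj₁; proj₂)
open import Relation.Nullary.Decidable using (⌊_⌋)
open import Data.List.Sort.InsertionSort ≤-decTotalOrder using (sort)

Adj : ℕ → Set
Adj n = Fin n → Fin n → Bool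

Symmetric : ∀ {n} → Adj n → Set
Symmetric {n} G = ∀ (u v : Fin n) → G u v ≡ G v u
  where open import Relation.Binary.PropositionalEquality using (_≡_)

Irreflexive : ∀ {n} → Adj n → Set
Irreflexive {n} G = ∀ (u : Fin n) → G u u ≡ false
  where open import Relation.Binary.PropositionalEquality using (_≡_)

-- allowed x : whether vertex x may be used (to describe induced subgraphs G - x)
-- reachW allowed G k u v : there is a walk of length ≤ k from u to v
--   all of whose vertices satisfy 'allowed' (u is assumed allowed)
reachW : ∀ {n} → (Fin n → Bool) → Adj n → ℕ → Fin n → Fin n → Bool
reachW ok G zero    u v = ⌊ u ≟ v ⌋
reachW ok G (suc k) u v =
  reachW ok G k u v ∨ any (λ w → reachW ok G k u w ∧ G w v) (allFin _) ∧ ok v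

reach : ∀ {n} → Adj n → ℕ → Fin n → Fin n → Bool
reach G = reachW (λ _ → true) G

Connected : ∀ {n} → Adj n → Set
Connected {n} G = ∀ (u v : Fin n) → T (reach G n u v)

ConnectedWithout : ∀ {n} → Adj n → Fin n → Set
ConnectedWithout {n} G x =
  ∀ (u v : Fin n) → T (not ⌊ u ≟ x ⌋) → T (not ⌊ v ≟ x ⌋) →
  T (reachW (λ w → not ⌊ w ≟ x ⌋) G n u v)

TwoConnected : ∀ {n} → Adj n → Set
TwoConnected {n} G = (3 ≤ n) × Connected G × (∀ (x : Fin n) → ConnectedWithout G x)

-- distance: least k with a walk of length ≤ k (search bounded by the
-- fuel; for connected graphs on n vertices fuel n suffices)
distFrom : ∀ {n} → Adj n → Fin n → Fin n → ℕ → ℕ → ℕ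
distFrom G u v k zero       = k
distFrom G u v k (suc fuel) =
  if reach G k u v then k else distFrom G u v (suc k) fuel

dist : ∀ {n} → Adj n → Fin n → Fin n → ℕ
dist {n} G u v = distFrom G u v 0 n

wiener : ∀ {n} → Adj n → ℕ
wiener {n} G =
  sum (concatMap (λ u → map (λ v → dist G u v)
                    (filter (λ v → toℕ u Data.Nat.<? toℕ v) (allFin n)))
                 (allFin n))
  where import Data.Nat

omega : ∀ {n} → Adj n → Fin n → ℕ → ℕ
omega {n} G v i = length (filter (λ x → dist G v x Data.Nat.≟ i) (allFin n))
  where import Data.Nat

kSearch : ∀ {n} → Adj n → Fin n → ℕ → ℕ → ℕ
kSearch {n} G v i zero       = n / 2
kSearch {n} G v i (suc fuel) =
  if 2 <ᵇ omega G v i then i else kSearch G v (suc i) fuel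

kv : ∀ {n} → Adj n → Fin n → ℕ
kv {n} G v = kSearch G v 1 (n ∸ 1)

kSeq : ∀ {n} → Adj n → List ℕ
kSeq {n} G = sort (map (kv G) (allFin n))

_⪯_ : List ℕ → List ℕ → Set
xs ⪯ ys = Pointwise _≤_ xs ys

_≺_ : List ℕ → List ℕ → Set
xs ≺ ys = (xs ⪯ ys) × Any (λ p → proj₁ p < proj₂ p) (zip xs ys)

-- The graph H_{n,p,q}: end-vertices 0 and 1; three internally disjoint
-- 0–1 paths of lengths p, q, n-p-q+1. Internal vertices (in order from 0):
--   path 1: 2, …, p ;  path 2: p+1, …, p+q-1 ;  path 3: p+q, …, n-1.
range : ℕ → ℕ → List ℕ
range a zero    = []
range a (suc c) = a ∷ range (suc a) c

consec : List ℕ → List (ℕ × ℕ)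
consec []            = []
consec (x ∷ [])      = []
consec (x ∷ y ∷ xs)  = (x , y) ∷ consec (y ∷ xs)

pathEdges : List ℕ → List (ℕ × ℕ)
pathEdges internal = consec (0 ∷ internal ++ (1 ∷ []))

hEdges : ℕ → ℕ → ℕ → List (ℕ × ℕ)
hEdges n p q =
  pathEdges (range 2 (p ∸ 1)) ++
  pathEdges (range (p + 1) (q ∸ 1)) ++
  pathEdges (range (p + q) (n ∸ (p + q)))

H : (n p q : ℕ) → Adj n
H n p q u v =
  any (λ e → ((proj₁ e ≡ᵇ toℕ u) ∧ (proj₂ e ≡ᵇ toℕ v)) ∨
             ((proj₁ e ≡ᵇ toℕ v) ∧ (proj₂ e ≡ᵇ toℕ u)))
      (hEdges n p q)

module Submission where

-- With B_r(v) the ball of radius r around v, the transmission of v is Σ_{r<n} (n − |B_r(v)|).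
-- In a 2-connected graph every distance level before the last one has at least two vertices,
-- and level k = k(v) has at least three, so |B_r(v)| ≥ 2r + 1 for r < k and ≥ 2r + 2 for r ≥ k
-- unless B_r(v) is everything: the transmission of v is at most a quantity T(k) that increases
-- with k, strictly while 2k + 2 ≤ n. The graphs H_{n,1,2} and H_{n,2,2} are a cycle of length
-- n − 1 plus one vertex, so their balls have at most 2r + 2 vertices, and at most 2r + 1 below
-- k(v); there the transmission of v is at least T(k(v)). Hence 2W(G) ≤ Σ T(k_i(G)) < Σ T(k_i(H))
-- ≤ 2W(H), the middle step being strict because k(v) = ⌊n/2⌋ or 2k(v) + 2 ≤ n in G, while
-- k(v) ≤ ⌊n/2⌋ in H, whose diameter is ⌊n/2⌋.

open import Defs
open import Data.Bool using (Bool; true; false; _∧_; _∨_; not; T; if_then_else_)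
open import Data.Bool.ListAction using (any)
open import Data.Bool.Properties using (T-∨; T-∧; ∨-comm)
open import Data.Empty using (⊥; ⊥-elim)
open import Data.Fin using (Fin; toℕ; fromℕ<; _≟_)
open import Data.Fin.Properties using (toℕ<n; toℕ-injective; toℕ-fromℕ<)
open import Data.List using (List; []; _∷_; _++_; map; length; filter; concatMap; allFin; upTo)
open import Data.List.Membership.Propositional using (_∈_; lose; find)
open import Data.List.Membership.Propositional.Properties using (∈-allFin; ∈-map⁺; ∈-upTo⁺; ∈-++⁻; ∈-++⁺ˡ; ∈-++⁺ʳ)
open import Data.List.Properties using (length-tabulate; length-map; length-upTo; map-∘; filter-some; filter-none)
open import Data.List.Relation.Binary.Permutation.Propositional using (↭-sym)
open import Data.List.Relation.Binary.Permutation.Propositional.Properties using (All-resp-↭; map⁺)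
open import Data.List.Relation.Binary.Pointwise using ([]; _∷_)
open import Data.List.Relation.Unary.All using (All; []; _∷_; universal) renaming (map to All-map)
open import Data.List.Relation.Unary.All.Properties using () renaming (map⁺ to All-map⁺)
open import Data.List.Relation.Unary.AllPairs using (_∷_)
open import Data.List.Relation.Unary.Any using (Any; here; there)
open import Data.List.Relation.Unary.Any.Properties using (any⁺; any⁻)
open import Data.List.Relation.Unary.Unique.Propositional using (Unique)
open import Data.List.Relation.Unary.Unique.Propositional.Properties using (allFin⁺)
open import Data.Nat using (ℕ; zero; suc; _+_; _*_; _∸_; _≤_; _<_; z≤n; s≤s; z<s; _⊓_; _%_; ∣_-_∣; _/_; _≤?_; _<?_; _<ᵇ_; _≡ᵇ_; NonZero)
import Data.Nat as ℕ
open import Data.Nat.DivMod using (m≡m%n+[m/n]*n; m%n<n; [m+kn]%n≡m%n; m<n⇒m%n≡m)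
open import Data.Nat.ListAction using (sum)
open import Data.Nat.ListAction.Properties using (sum-++; sum-↭)
open import Data.Nat.Properties hiding (_≟_)
open import Algebra.Properties.CommutativeSemigroup +-commutativeSemigroup using () renaming (interchange to +-interchange)
open import Data.Nat.Tactic.RingSolver using (solve-∀)
open import Data.List.Sort.InsertionSort ≤-decTotalOrder using (sort)
open import Data.List.Sort.InsertionSort.Properties ≤-decTotalOrder using (sort-↭)
open import Data.Product using (_×_; _,_; proj₁; proj₂; ∃-syntax)
open import Data.Sum using (_⊎_; inj₁; inj₂; [_,_]′; swap)
open import Data.Unit using (tt)
open import Function using (_∘_)
open import Function.Bundles using (Equivalence)
open import Level using (0ℓ)
open import Relation.Binary.Definitions using (tri<; tri≈; tri>)
open import Relation.Binary.PropositionalEquality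
  using (_≡_; _≢_; refl; sym; trans; cong; cong₂; subst; subst₂; module ≡-Reasoning)
open import Relation.Nullary using (¬_; Dec; yes; no; does; contradiction)
open import Relation.Nullary.Decidable using (⌊_⌋; toWitness; fromWitness; toWitnessFalse; fromWitnessFalse; _⊎-dec_; _×-dec_; ¬?)
open import Relation.Unary using (Pred; Decidable; _⊆_; _∪_)

open Equivalence using (to; from)

module _ {A : Set} where

  count : {P : Pred A 0ℓ} → Decidable P → List A → ℕ
  count P? xs = length (filter P? xs)

  count≤length : {P : Pred A 0ℓ} (P? : Decidable P) (xs : List A) → count P? xs ≤ length xs
  count≤length P? [] = z≤n
  count≤length P? (x ∷ xs) with P? x
  ... | yes _ = s≤s (count≤length P? xs)
  ... | no _  = m≤n⇒m≤1+n (count≤length P? xs)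

  count-mono : {P Q : Pred A 0ℓ} (P? : Decidable P) (Q? : Decidable Q) →
               P ⊆ Q → ∀ xs → count P? xs ≤ count Q? xs
  count-mono P? Q? P⊆Q [] = z≤n
  count-mono P? Q? P⊆Q (x ∷ xs) with P? x | Q? x
  ... | yes _ | yes _ = s≤s (count-mono P? Q? P⊆Q xs)
  ... | yes p | no ¬q = contradiction (P⊆Q p) ¬q
  ... | no _  | yes _ = m≤n⇒m≤1+n (count-mono P? Q? P⊆Q xs)
  ... | no _  | no _  = count-mono P? Q? P⊆Q xs

  count-≤-+ : {P Q R : Pred A 0ℓ} (P? : Decidable P) (Q? : Decidable Q) (R? : Decidable R) →
              P ⊆ Q ∪ R → ∀ xs → count P? xs ≤ count Q? xs + count R? xs
  count-≤-+ P? Q? R? P⊆Q∪R [] = z≤n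
  count-≤-+ P? Q? R? P⊆Q∪R (x ∷ xs) with count-≤-+ P? Q? R? P⊆Q∪R xs | P? x | Q? x | R? x
  ... | ih | yes _ | yes _ | yes _ = s≤s (≤-trans ih (+-monoʳ-≤ _ (n≤1+n _)))
  ... | ih | yes _ | yes _ | no _  = s≤s ih
  ... | ih | yes _ | no _  | yes _ = ≤-trans (s≤s ih) (≤-reflexive (sym (+-suc _ _)))
  ... | _  | yes p | no ¬q | no ¬r = contradiction (P⊆Q∪R p) [ ¬q , ¬r ]′
  ... | ih | no _  | yes _ | yes _ = ≤-trans ih (≤-trans (n≤1+n _) (s≤s (+-monoʳ-≤ _ (n≤1+n _))))
  ... | ih | no _  | yes _ | no _  = m≤n⇒m≤1+n ih
  ... | ih | no _  | no _  | yes _ = ≤-trans ih (+-monoʳ-≤ _ (n≤1+n _))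
  ... | ih | no _  | no _  | no _  = ih

  count-split : {P Q R : Pred A 0ℓ} (P? : Decidable P) (Q? : Decidable Q) (R? : Decidable R) →
                P ⊆ Q ∪ R → Q ⊆ P → R ⊆ P → (∀ {x} → Q x → R x → ⊥) →
                ∀ xs → count P? xs ≡ count Q? xs + count R? xs
  count-split P? Q? R? P⊆Q∪R Q⊆P R⊆P disj [] = refl
  count-split P? Q? R? P⊆Q∪R Q⊆P R⊆P disj (x ∷ xs)
    with count-split P? Q? R? P⊆Q∪R Q⊆P R⊆P disj xs | P? x | Q? x | R? x
  ... | _  | _     | yes q | yes r = contradiction r (disj q)
  ... | ih | yes _ | yes _ | no _  = cong suc ih
  ... | ih | yes _ | no _  | yes _ = trans (cong suc ih) (sym (+-suc _ _))
  ... | _  | yes p | no ¬q | no ¬r = contradiction (P⊆Q∪R p) [ ¬q , ¬r ]′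
  ... | _  | no ¬p | yes q | no _  = contradiction (Q⊆P q) ¬p
  ... | _  | no ¬p | no _  | yes r = contradiction (R⊆P r) ¬p
  ... | ih | no _  | no _  | no _  = ih

  count-complement : {P Q : Pred A 0ℓ} (P? : Decidable P) (Q? : Decidable Q) →
                     (∀ x → P x ⊎ Q x) → (∀ {x} → P x → Q x → ⊥) →
                     ∀ xs → count P? xs + count Q? xs ≡ length xs
  count-complement P? Q? P∪Q disj [] = refl
  count-complement P? Q? P∪Q disj (x ∷ xs)
    with count-complement P? Q? P∪Q disj xs | P? x | Q? x
  ... | _  | yes p | yes q = contradiction q (disj p)
  ... | ih | yes _ | no _  = cong suc ih
  ... | ih | no _  | yes _ = trans (+-suc _ _) (cong suc ih)
  ... | _  | no ¬p | no ¬q = contradiction (P∪Q x) [ ¬p , ¬q ]′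

  count>0⇒∃ : {P : Pred A 0ℓ} (P? : Decidable P) (xs : List A) → 0 < count P? xs → ∃[ x ] P x
  count>0⇒∃ P? (x ∷ xs) pos with P? x
  ... | yes p = x , p
  ... | no _  = count>0⇒∃ P? xs pos

  count≤1 : {P : Pred A 0ℓ} (P? : Decidable P) (xs : List A) → Unique xs →
            (∀ {x y} → P x → P y → x ≡ y) → count P? xs ≤ 1
  count≤1 P? [] _ _ = z≤n
  count≤1 P? (x ∷ xs) (x∉xs ∷ uniq) P-unique with P? x
  ... | no _  = count≤1 P? xs uniq P-unique
  ... | yes p = s≤s (≤-reflexive (cong length (filter-none P? (All-map (λ x≢y py → x≢y (P-unique p py)) x∉xs))))

  count-injective≤length : {P : Pred A 0ℓ} (P? : Decidable P) (xs : List A) → Unique xs →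
                           (f : A → ℕ) → (∀ {x y} → P x → P y → f x ≡ f y → x ≡ y) →
                           ∀ zs → (∀ {x} → P x → f x ∈ zs) → count P? xs ≤ length zs
  count-injective≤length P? xs uniq f inj [] image =
    ≤-reflexive (cong length (filter-none P? (universal (λ _ px → contradiction (image px) λ ()) xs)))
  count-injective≤length {P} P? xs uniq f inj (z ∷ zs) image = begin
    count P? xs                                               ≤⟨ count-≤-+ P? hits misses split xs ⟩
    count hits xs + count misses xs                           ≤⟨ +-mono-≤ at-most-one (count-injective≤length misses xs uniq f
                                                                   (λ (px , _) (py , _) → inj px py) zs image′) ⟩
    1 + length zs                                             ∎
    where
    open ≤-Reasoning
    hits : Decidable (λ x → P x × f x ≡ z)
    hits x = P? x ×-dec (f x ℕ.≟ z)
    misses : Decidable (λ x → P x × f x ≢ z)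
    misses x = P? x ×-dec ¬? (f x ℕ.≟ z)
    split : ∀ {x} → P x → (P x × f x ≡ z) ⊎ (P x × f x ≢ z)
    split {x} px with f x ℕ.≟ z
    ... | yes fx≡z = inj₁ (px , fx≡z)
    ... | no fx≢z  = inj₂ (px , fx≢z)
    at-most-one : count hits xs ≤ 1
    at-most-one = count≤1 hits xs uniq (λ (px , fx≡z) (py , fy≡z) → inj px py (trans fx≡z (sym fy≡z)))
    image′ : ∀ {x} → P x × f x ≢ z → f x ∈ zs
    image′ (px , fx≢z) with image px
    ... | here fx≡z  = contradiction fx≡z fx≢z
    ... | there fx∈zs = fx∈zs

module _ {A : Set} where

  sum-map-mono : (f g : A → ℕ) (xs : List A) → (∀ x → f x ≤ g x) → sum (map f xs) ≤ sum (map g xs)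
  sum-map-mono f g [] f≤g = z≤n
  sum-map-mono f g (x ∷ xs) f≤g = +-mono-≤ (f≤g x) (sum-map-mono f g xs f≤g)

  sum-map-cong : (f g : A → ℕ) (xs : List A) → (∀ x → f x ≡ g x) → sum (map f xs) ≡ sum (map g xs)
  sum-map-cong f g [] f≡g = refl
  sum-map-cong f g (x ∷ xs) f≡g = cong₂ _+_ (f≡g x) (sum-map-cong f g xs f≡g)

  sum-map-+ : (f g : A → ℕ) (xs : List A) →
              sum (map (λ x → f x + g x) xs) ≡ sum (map f xs) + sum (map g xs)
  sum-map-+ f g [] = refl
  sum-map-+ f g (x ∷ xs) = trans (cong (f x + g x +_) (sum-map-+ f g xs)) (+-interchange (f x) (g x) _ _)

  sum-map-zero : (xs : List A) → sum (map (λ _ → 0) xs) ≡ 0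
  sum-map-zero [] = refl
  sum-map-zero (x ∷ xs) = sum-map-zero xs

  sum-concatMap : (f : A → List ℕ) (xs : List A) → sum (concatMap f xs) ≡ sum (map (sum ∘ f) xs)
  sum-concatMap f [] = refl
  sum-concatMap f (x ∷ xs) = trans (sum-++ (f x) (concatMap f xs)) (cong (sum (f x) +_) (sum-concatMap f xs))

  sum-map-filter : {P : Pred A 0ℓ} (P? : Decidable P) (f : A → ℕ) (xs : List A) →
    sum (map f (filter P? xs)) ≡ sum (map (λ x → if does (P? x) then f x else 0) xs)
  sum-map-filter P? f [] = refl
  sum-map-filter P? f (x ∷ xs) with P? x
  ... | yes _ = cong (f x +_) (sum-map-filter P? f xs)
  ... | no _  = sum-map-filter P? f xs

  sum-map-indicator : {P : Pred A 0ℓ} (P? : Decidable P) (xs : List A) →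
    sum (map (λ x → if does (P? x) then 1 else 0) xs) ≡ count P? xs
  sum-map-indicator P? [] = refl
  sum-map-indicator P? (x ∷ xs) with P? x
  ... | yes _ = cong suc (sum-map-indicator P? xs)
  ... | no _  = sum-map-indicator P? xs

sum-map-swap : {A B : Set} (g : A → B → ℕ) (xs : List A) (ys : List B) →
  sum (map (λ x → sum (map (g x) ys)) xs) ≡ sum (map (λ y → sum (map (λ x → g x y) xs)) ys)
sum-map-swap g [] ys = sym (sum-map-zero ys)
sum-map-swap g (x ∷ xs) ys =
  trans (cong (sum (map (g x) ys) +_) (sum-map-swap g xs ys))
        (sym (sum-map-+ (g x) (λ y → sum (map (λ x → g x y) xs)) ys))

-- Walks and distances

module _ {n : ℕ} (G : Adj n) where

  reachW-step : ∀ (ok : Fin n → Bool) k u w v →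
                T (reachW ok G k u w) → T (G w v) → T (ok v) → T (reachW ok G (suc k) u v)
  reachW-step ok k u w v u⇝w wv ok-v =
    from T-∨ (inj₂ (from T-∧ (any⁺ _ (lose (∈-allFin w) (from T-∧ (u⇝w , wv))) , ok-v)))

  reachW-split : ∀ (ok : Fin n → Bool) k u v → T (reachW ok G (suc k) u v) →
                 T (reachW ok G k u v) ⊎ ((∃[ w ] (T (reachW ok G k u w) × T (G w v))) × T (ok v))
  reachW-split ok k u v u⇝v with to T-∨ u⇝v
  ... | inj₁ u⇝v′ = inj₁ u⇝v′
  ... | inj₂ step with to T-∧ step
  ... | some , ok-v with find (any⁻ _ (allFin n) some)
  ... | w , _ , u⇝w∧wv = inj₂ ((w , to T-∧ u⇝w∧wv) , ok-v)

  reachW-zero : ∀ (ok : Fin n → Bool) u v → T (reachW ok G 0 u v) → u ≡ v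
  reachW-zero ok u v = toWitness

  reach-refl : ∀ u → T (reach G 0 u u)
  reach-refl u = fromWitness refl

  reach-step : ∀ k u w v → T (reach G k u w) → T (G w v) → T (reach G (suc k) u v)
  reach-step k u w v u⇝w wv = reachW-step (λ _ → true) k u w v u⇝w wv tt

  reach-split : ∀ k u v → T (reach G (suc k) u v) →
                T (reach G k u v) ⊎ ∃[ w ] (T (reach G k u w) × T (G w v))
  reach-split k u v u⇝v with reachW-split (λ _ → true) k u v u⇝v
  ... | inj₁ u⇝v′      = inj₁ u⇝v′
  ... | inj₂ (step , _) = inj₂ step

  reach-suc : ∀ k u v → T (reach G k u v) → T (reach G (suc k) u v)
  reach-suc k u v = from T-∨ ∘ inj₁

  reach-trans : ∀ k l u w v → T (reach G k u w) → T (reach G l w v) → T (reach G (k + l) u v)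
  reach-trans k zero u w v u⇝w w⇝v with reachW-zero (λ _ → true) w v w⇝v
  ... | refl rewrite +-identityʳ k = u⇝w
  reach-trans k (suc l) u w v u⇝w w⇝v rewrite +-suc k l with reach-split l w v w⇝v
  ... | inj₁ w⇝v′           = reach-suc (k + l) u v (reach-trans k l u w v u⇝w w⇝v′)
  ... | inj₂ (z , w⇝z , zv) = reach-step (k + l) u z v (reach-trans k l u w z u⇝w w⇝z) zv

  reach-sym : Symmetric G → ∀ k u v → T (reach G k u v) → T (reach G k v u)
  reach-sym G-sym zero u v u⇝v with reachW-zero (λ _ → true) u v u⇝v
  ... | refl = u⇝v
  reach-sym G-sym (suc k) u v u⇝v with reach-split k u v u⇝v
  ... | inj₁ u⇝v′           = reach-suc k v u (reach-sym G-sym k u v u⇝v′)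
  ... | inj₂ (w , u⇝w , wv) =
    reach-trans 1 k v w u (reach-step 0 v v w (reach-refl v) (subst T (G-sym w v) wv))
                          (reach-sym G-sym k u w u⇝w)

  distFrom≤ : ∀ u v j fuel → distFrom G u v j fuel ≤ j + fuel
  distFrom≤ u v j zero = ≤-reflexive (sym (+-identityʳ j))
  distFrom≤ u v j (suc fuel) with reach G j u v
  ... | true  = m≤m+n j (suc fuel)
  ... | false = ≤-trans (distFrom≤ u v (suc j) fuel) (≤-reflexive (sym (+-suc j fuel)))

  distFrom-minimal : ∀ u v j fuel k → T (reach G k u v) → j ≤ k → distFrom G u v j fuel ≤ k
  distFrom-minimal u v j zero k _ j≤k = j≤k
  distFrom-minimal u v j (suc fuel) k u⇝v j≤k with reach G j u v in eq
  ... | true = j≤k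
  ... | false with m≤n⇒m<n∨m≡n j≤k
  ... | inj₁ j<k  = distFrom-minimal u v (suc j) fuel k u⇝v j<k
  ... | inj₂ refl = ⊥-elim (subst T eq u⇝v)

  distFrom-unreached : ∀ u v j fuel → (∀ m → m < j → ¬ T (reach G m u v)) →
                       ∀ m → m < distFrom G u v j fuel → ¬ T (reach G m u v)
  distFrom-unreached u v j zero below = below
  distFrom-unreached u v j (suc fuel) below with reach G j u v in eq
  ... | true  = below
  ... | false = distFrom-unreached u v (suc j) fuel below′
    where
    below′ : ∀ m → m < suc j → ¬ T (reach G m u v)
    below′ m (s≤s m≤j) with m≤n⇒m<n∨m≡n m≤j
    ... | inj₁ m<j  = below m m<j
    ... | inj₂ refl = subst T eq

  distFrom-reached : ∀ u v j fuel →
    T (reach G (distFrom G u v j fuel) u v) ⊎ distFrom G u v j fuel ≡ j + fuel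
  distFrom-reached u v j zero = inj₂ (sym (+-identityʳ j))
  distFrom-reached u v j (suc fuel) with reach G j u v in eq
  ... | true = inj₁ (subst T (sym eq) tt)
  ... | false with distFrom-reached u v (suc j) fuel
  ... | inj₁ u⇝v = inj₁ u⇝v
  ... | inj₂ e   = inj₂ (trans e (sym (+-suc j fuel)))

  dist≤n : ∀ u v → dist G u v ≤ n
  dist≤n u v = distFrom≤ u v 0 n

  dist-minimal : ∀ u v k → T (reach G k u v) → dist G u v ≤ k
  dist-minimal u v k u⇝v = distFrom-minimal u v 0 n k u⇝v z≤n

  dist-unreached : ∀ u v m → m < dist G u v → ¬ T (reach G m u v)
  dist-unreached u v = distFrom-unreached u v 0 n (λ _ ())

  dist-reached : ∀ u v → T (reach G (dist G u v) u v) ⊎ dist G u v ≡ n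
  dist-reached u v = distFrom-reached u v 0 n

  reach-dist : Connected G → ∀ u v → T (reach G (dist G u v) u v)
  reach-dist conn u v with dist-reached u v
  ... | inj₁ u⇝v = u⇝v
  ... | inj₂ e   = subst (λ j → T (reach G j u v)) (sym e) (conn u v)

  dist-≥ : ∀ u v l → l ≤ n → (∀ k → T (reach G k u v) → l ≤ k) → l ≤ dist G u v
  dist-≥ u v l l≤n walk≥ with dist-reached u v
  ... | inj₁ u⇝v = walk≥ _ u⇝v
  ... | inj₂ e   = subst (l ≤_) (sym e) l≤n

  dist≡0⇒≡ : ∀ u v → dist G u v ≡ 0 → u ≡ v
  dist≡0⇒≡ u v d≡0 with dist-reached u v
  ... | inj₁ u⇝v = reachW-zero (λ _ → true) u v (subst (λ j → T (reach G j u v)) d≡0 u⇝v)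
  ... | inj₂ d≡n with trans (sym d≡n) d≡0
  ... | refl with u
  ... | ()

  dist-refl : ∀ u → dist G u u ≡ 0
  dist-refl u = n≤0⇒n≡0 (dist-minimal u u 0 (reach-refl u))

  dist-edge : Connected G → ∀ v w y → T (G w y) → dist G v y ≤ suc (dist G v w)
  dist-edge conn v w y wy = dist-minimal v y (suc (dist G v w)) (reach-step (dist G v w) v w y (reach-dist conn v w) wy)

  dist-pred : Connected G → ∀ v y i → dist G v y ≡ suc i → ∃[ w ] (T (G w y) × dist G v w ≡ i)
  dist-pred conn v y i d≡1+i
    with reach-split i v y (subst (λ j → T (reach G j v y)) d≡1+i (reach-dist conn v y))
  ... | inj₁ v⇝y = contradiction v⇝y (dist-unreached v y i (subst (i <_) (sym d≡1+i) ≤-refl))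
  ... | inj₂ (w , v⇝w , wy) = w , wy , ≤-antisym (dist-minimal v w i v⇝w) i≤d
    where
    i≤d : i ≤ dist G v w
    i≤d = ≮⇒≥ λ d<i → n≮n i (subst (_≤ i) d≡1+i (≤-trans (dist-edge conn v w y wy) d<i))

  dist-sym : Symmetric G → ∀ u v → dist G u v ≡ dist G v u
  dist-sym G-sym u v = go 0 n
    where
    reach≡ : ∀ k → reach G k u v ≡ reach G k v u
    reach≡ k with reach G k u v in e₁ | reach G k v u in e₂
    ... | true  | true  = refl
    ... | false | false = refl
    ... | true  | false = ⊥-elim (subst T e₂ (reach-sym G-sym k u v (subst T (sym e₁) tt)))
    ... | false | true  = ⊥-elim (subst T e₁ (reach-sym G-sym k v u (subst T (sym e₂) tt)))
    go : ∀ j fuel → distFrom G u v j fuel ≡ distFrom G v u j fuel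
    go j zero = refl
    go j (suc fuel) rewrite reach≡ j with reach G j v u
    ... | true  = refl
    ... | false = go (suc j) fuel

-- Balls and distance levels

≤⊎> : ∀ m n → m ≤ n ⊎ n < m
≤⊎> m n with m ≤? n
... | yes m≤n = inj₁ m≤n
... | no m≰n  = inj₂ (≰⇒> m≰n)

length-allFin : ∀ n → length (allFin n) ≡ n
length-allFin n = length-tabulate (λ x → x)

count-≟-allFin : ∀ {n} (v : Fin n) → count (_≟ v) (allFin n) ≡ 1
count-≟-allFin {n} v = ≤-antisym (count≤1 (_≟ v) (allFin n) (allFin⁺ n) (λ x≡v y≡v → trans x≡v (sym y≡v)))
                                (filter-some (_≟ v) (lose (∈-allFin v) refl))

count-allFin≥2 : ∀ {n} {P : Pred (Fin n) 0ℓ} (P? : Decidable P) {a b : Fin n} →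
                 a ≢ b → P a → P b → 2 ≤ count P? (allFin n)
count-allFin≥2 {n} {P} P? {a} {b} a≢b pa pb = begin
  2                                                   ≡⟨ cong₂ _+_ (count-≟-allFin a) (count-≟-allFin b) ⟨
  count (_≟ a) (allFin n) + count (_≟ b) (allFin n)   ≡⟨ count-split (λ x → (x ≟ a) ⊎-dec (x ≟ b)) (_≟ a) (_≟ b)
                                                           (λ x → x) inj₁ inj₂ (λ x≡a x≡b → a≢b (trans (sym x≡a) x≡b)) (allFin n) ⟨
  count (λ x → (x ≟ a) ⊎-dec (x ≟ b)) (allFin n)     ≤⟨ count-mono _ P? a-or-b (allFin n) ⟩
  count P? (allFin n)                                 ∎
  where
  open ≤-Reasoning
  a-or-b : ∀ {x} → x ≡ a ⊎ x ≡ b → P x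
  a-or-b (inj₁ refl) = pa
  a-or-b (inj₂ refl) = pb

module _ {n : ℕ} (G : Adj n) (v : Fin n) where

  ballSize : ℕ → ℕ
  ballSize r = count (λ x → dist G v x ≤? r) (allFin n)

  ballSize-zero : ballSize 0 ≡ 1
  ballSize-zero = ≤-antisym
    (≤-trans (count-mono (λ x → dist G v x ≤? 0) (_≟ v) (λ d≤0 → sym (dist≡0⇒≡ G v _ (n≤0⇒n≡0 d≤0))) (allFin n))
             (≤-reflexive (count-≟-allFin v)))
    (filter-some (λ x → dist G v x ≤? 0) (lose (∈-allFin v) (≤-reflexive (dist-refl G v))))

  ballSize-suc : ∀ r → ballSize (suc r) ≡ ballSize r + omega G v (suc r)
  ballSize-suc r = count-split (λ x → dist G v x ≤? suc r) (λ x → dist G v x ≤? r) (λ x → dist G v x ℕ.≟ suc r)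
    ≤-suc m≤n⇒m≤1+n ≤-reflexive (λ d≤r d≡1+r → n≮n r (subst (_≤ r) d≡1+r d≤r)) (allFin n)
    where
    ≤-suc : ∀ {d} → d ≤ suc r → d ≤ r ⊎ d ≡ suc r
    ≤-suc d≤1+r with m≤n⇒m<n∨m≡n d≤1+r
    ... | inj₁ (s≤s d≤r) = inj₁ d≤r
    ... | inj₂ d≡1+r     = inj₂ d≡1+r

  ballSize≤ballSize-suc : ∀ r → ballSize r ≤ ballSize (suc r)
  ballSize≤ballSize-suc r = ≤-trans (m≤m+n _ _) (≤-reflexive (sym (ballSize-suc r)))

  ballSize≤n : ∀ r → ballSize r ≤ n
  ballSize≤n r = ≤-trans (count≤length (λ x → dist G v x ≤? r) (allFin n)) (≤-reflexive (length-allFin n))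

  ballSize+outside : ∀ r → ballSize r + count (λ x → r <? dist G v x) (allFin n) ≡ n
  ballSize+outside r = trans (count-complement (λ x → dist G v x ≤? r) (λ x → r <? dist G v x)
                                                (λ x → ≤⊎> (dist G v x) r) (λ d≤r r<d → <⇒≱ r<d d≤r) (allFin n))
                             (length-allFin n)

  ballSize<n⇒outside : ∀ r → ballSize r < n → ∃[ y ] r < dist G v y
  ballSize<n⇒outside r ball<n with count (λ x → r <? dist G v x) (allFin n) in outside
  ... | suc _ = count>0⇒∃ (λ x → r <? dist G v x) (allFin n) (subst (0 <_) (sym outside) z<s)
  ... | zero  = contradiction (trans (sym (+-identityʳ _)) (trans (cong (ballSize r +_) (sym outside)) (ballSize+outside r)))
                              (<⇒≢ ball<n)

  dist-intermediate : Connected G → ∀ d y m → dist G v y ≡ d → m ≤ d → ∃[ z ] dist G v z ≡ m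
  dist-intermediate conn d y m dy≡d m≤d with m≤n⇒m<n∨m≡n m≤d
  ... | inj₂ refl = y , dy≡d
  dist-intermediate conn (suc d) y m dy≡d m≤d | inj₁ (s≤s m≤d′) with dist-pred G conn v y d dy≡d
  ... | w , _ , dw≡d = dist-intermediate conn d w m dw≡d m≤d′

  -- A lone vertex z at distance j would separate v from every vertex beyond level j.
  twoConnected⇒omega≥2 : TwoConnected G → ∀ j y → 1 ≤ j → j < dist G v y → 2 ≤ omega G v j
  twoConnected⇒omega≥2 (_ , conn , conn-without) j y 1≤j j<dy with 2 ≤? omega G v j
  ... | yes 2≤ω = 2≤ω
  ... | no ω≱2 = contradiction (within-level n (conn-without z v y (fromWitnessFalse v≢z) (fromWitnessFalse y≢z)))
                               (<-asym j<dy)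
    where
    level-j : ∃[ z ] dist G v z ≡ j
    level-j = dist-intermediate conn (dist G v y) y j refl (<⇒≤ j<dy)
    z : Fin n
    z = proj₁ level-j
    dz≡j : dist G v z ≡ j
    dz≡j = proj₂ level-j
    unique : ∀ u → dist G v u ≡ j → u ≡ z
    unique u du≡j with u ≟ z
    ... | yes u≡z = u≡z
    ... | no u≢z  = contradiction (count-allFin≥2 (λ x → dist G v x ℕ.≟ j) u≢z du≡j dz≡j) ω≱2
    v≢z : v ≢ z
    v≢z v≡z = <⇒≢ 1≤j (trans (sym (dist-refl G v)) (trans (cong (dist G v) v≡z) dz≡j))
    y≢z : y ≢ z
    y≢z y≡z = <⇒≢ j<dy (sym (trans (cong (dist G v) y≡z) dz≡j))
    within-level : ∀ k {u} → T (reachW (λ w → not ⌊ w ≟ z ⌋) G k v u) → dist G v u < j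
    within-level zero {u} v⇝u with reachW-zero G (λ w → not ⌊ w ≟ z ⌋) v u v⇝u
    ... | refl = subst (_< j) (sym (dist-refl G v)) 1≤j
    within-level (suc k) {u} v⇝u with reachW-split G (λ w → not ⌊ w ≟ z ⌋) k v u v⇝u
    ... | inj₁ v⇝u′ = within-level k v⇝u′
    ... | inj₂ ((w , v⇝w , wu) , u≢z) with m≤n⇒m<n∨m≡n (≤-trans (dist-edge G conn v w u wu) (within-level k v⇝w))
    ... | inj₁ du<j  = du<j
    ... | inj₂ du≡j = contradiction (unique u du≡j) (toWitnessFalse u≢z)

sumBelow : ℕ → (ℕ → ℕ) → ℕ
sumBelow zero    f = 0
sumBelow (suc m) f = sumBelow m f + f m

sumBelow-mono : ∀ m {f g} → (∀ r → r < m → f r ≤ g r) → sumBelow m f ≤ sumBelow m g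
sumBelow-mono zero    f≤g = z≤n
sumBelow-mono (suc m) f≤g = +-mono-≤ (sumBelow-mono m (λ r r<m → f≤g r (m<n⇒m<1+n r<m))) (f≤g m ≤-refl)

sumBelow-strict : ∀ m {f g} → (∀ r → r < m → f r ≤ g r) → ∀ {r} → r < m → f r < g r → sumBelow m f < sumBelow m g
sumBelow-strict (suc m) f≤g {r} (s≤s r≤m) fr<gr with m≤n⇒m<n∨m≡n r≤m
... | inj₁ r<m  = +-mono-<-≤ (sumBelow-strict m (λ r r<m → f≤g r (m<n⇒m<1+n r<m)) r<m fr<gr) (f≤g m ≤-refl)
... | inj₂ refl = +-mono-≤-< (sumBelow-mono m (λ r r<m → f≤g r (m<n⇒m<1+n r<m))) fr<gr

∑ : ∀ {n} → (Fin n → ℕ) → ℕ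
∑ {n} f = sum (map f (allFin n))

transmission : ∀ {n} → Adj n → Fin n → ℕ
transmission G v = ∑ (dist G v)

-- Σ_y d(v,y) = Σ_{r<n} #{y : d(v,y) > r}, computed through the truncations d ⊓ r.
transmission-by-balls : ∀ {n} (G : Adj n) v → transmission G v ≡ sumBelow n (λ r → n ∸ ballSize G v r)
transmission-by-balls {n} G v =
  trans (sum-map-cong (dist G v) (λ y → dist G v y ⊓ n) (allFin n) (λ y → sym (m≤n⇒m⊓n≡m (dist≤n G v y))))
        (truncated n)
  where
  outside : ℕ → Fin n → ℕ
  outside r y = if does (r <? dist G v y) then 1 else 0
  ⊓-suc : ∀ r y → dist G v y ⊓ suc r ≡ dist G v y ⊓ r + outside r y
  ⊓-suc r y with r <ᵇ dist G v y in eq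
  ... | true  = trans (m≥n⇒m⊓n≡n r<d) (trans (+-comm 1 r) (cong (_+ 1) (sym (m≥n⇒m⊓n≡n (<⇒≤ r<d)))))
    where
    r<d : r < dist G v y
    r<d = <ᵇ⇒< r _ (subst T (sym eq) tt)
  ... | false = trans (m≤n⇒m⊓n≡m (m≤n⇒m≤1+n d≤r)) (sym (trans (+-identityʳ _) (m≤n⇒m⊓n≡m d≤r)))
    where
    d≤r : dist G v y ≤ r
    d≤r = ≮⇒≥ (λ r<d → subst T eq (<⇒<ᵇ r<d))
  truncated : ∀ m → ∑ (λ y → dist G v y ⊓ m) ≡ sumBelow m (λ r → n ∸ ballSize G v r)
  truncated zero = trans (sum-map-cong _ (λ _ → 0) (allFin n) (λ y → ⊓-zeroʳ (dist G v y))) (sum-map-zero (allFin n))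
  truncated (suc m) = begin
    ∑ (λ y → dist G v y ⊓ suc m)
      ≡⟨ sum-map-cong _ _ (allFin n) (⊓-suc m) ⟩
    ∑ (λ y → dist G v y ⊓ m + outside m y)
      ≡⟨ sum-map-+ (λ y → dist G v y ⊓ m) (outside m) (allFin n) ⟩
    ∑ (λ y → dist G v y ⊓ m) + ∑ (outside m)
      ≡⟨ cong₂ _+_ (truncated m) (sum-map-indicator (λ x → m <? dist G v x) (allFin n)) ⟩
    sumBelow m (λ r → n ∸ ballSize G v r) + count (λ x → m <? dist G v x) (allFin n)
      ≡⟨ cong (sumBelow m (λ r → n ∸ ballSize G v r) +_)
              (trans (sym (m+n∸m≡n (ballSize G v m) _)) (cong (_∸ ballSize G v m) (ballSize+outside G v m))) ⟩
    sumBelow (suc m) (λ r → n ∸ ballSize G v r) ∎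
    where open ≡-Reasoning

-- The index k(v)

half-bounds : ∀ n → n / 2 + n / 2 ≤ n × n ≤ suc (n / 2 + n / 2)
half-bounds n =
  ≤-trans (≤-reflexive (sym 2h≡h+h)) (≤-trans (m≤n+m _ (n % 2)) (≤-reflexive (sym (m≡m%n+[m/n]*n n 2)))) ,
  ≤-trans (≤-reflexive (m≡m%n+[m/n]*n n 2)) (+-mono-≤ (≤-pred (m%n<n n 2)) (≤-reflexive 2h≡h+h))
  where
  2h≡h+h : n / 2 * 2 ≡ n / 2 + n / 2
  2h≡h+h = trans (*-comm (n / 2) 2) (cong (n / 2 +_) (+-identityʳ (n / 2)))

module _ {n : ℕ} (G : Adj n) (v : Fin n) where

  -- The value computed by kSearch from index i, when every index in [i, u) was examined.
  data CrowdingIndex (i u k : ℕ) : Set where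
    crowded   : i ≤ k → 2 < omega G v k → (∀ j → i ≤ j → j < k → omega G v j ≤ 2) → CrowdingIndex i u k
    uncrowded : k ≡ n / 2 → (∀ j → i ≤ j → j < u → omega G v j ≤ 2) → CrowdingIndex i u k

  kSearch-spec : ∀ i fuel → CrowdingIndex i (i + fuel) (kSearch G v i fuel)
  kSearch-spec i zero = uncrowded refl (λ j i≤j j<i+0 → contradiction i≤j (<⇒≱ (subst (j <_) (+-identityʳ i) j<i+0)))
  kSearch-spec i (suc fuel) with 2 <ᵇ omega G v i in eq
  ... | true  = crowded ≤-refl (<ᵇ⇒< 2 _ (subst T (sym eq) tt)) (λ j i≤j j<i → contradiction i≤j (<⇒≱ j<i))
  ... | false = extend (kSearch-spec (suc i) fuel)
    where
    ω≤2 : omega G v i ≤ 2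
    ω≤2 = ≮⇒≥ (λ 2<ω → subst T eq (<⇒<ᵇ 2<ω))
    from-i : ∀ {m} → (∀ j → suc i ≤ j → j < m → omega G v j ≤ 2) → ∀ j → i ≤ j → j < m → omega G v j ≤ 2
    from-i sparse j i≤j j<m with m≤n⇒m<n∨m≡n i≤j
    ... | inj₁ i<j  = sparse j i<j j<m
    ... | inj₂ refl = ω≤2
    extend : ∀ {k} → CrowdingIndex (suc i) (suc i + fuel) k → CrowdingIndex i (i + suc fuel) k
    extend (crowded i<k 2<ω sparse) = crowded (<⇒≤ i<k) 2<ω (from-i sparse)
    extend (uncrowded k≡h sparse)   = uncrowded k≡h (λ j i≤j j< → from-i sparse j i≤j (subst (j <_) (+-suc i fuel) j<))

  kv-spec : 1 ≤ n → CrowdingIndex 1 n (kv G v)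
  kv-spec 1≤n with kSearch-spec 1 (n ∸ 1)
  ... | crowded 1≤k 2<ω sparse = crowded 1≤k 2<ω sparse
  ... | uncrowded k≡h sparse   = uncrowded k≡h (λ j 1≤j j<n → sparse j 1≤j (subst (j <_) (sym (m+[n∸m]≡n 1≤n)) j<n))

  1≤kv : 2 ≤ n → 1 ≤ kv G v
  1≤kv 2≤n with kv-spec (≤-trans (s≤s z≤n) 2≤n)
  ... | crowded 1≤k _ _ = 1≤k
  ... | uncrowded k≡h _ = subst (1 ≤_) (sym k≡h) 1≤h
    where
    1≤h : 1 ≤ n / 2
    1≤h with n / 2 | half-bounds n
    ... | zero  | _ , n≤1 = contradiction n≤1 (<⇒≱ 2≤n)
    ... | suc _ | _       = s≤s z≤n

  omega≤2-below-kv : 2 ≤ n → ∀ j → 1 ≤ j → j < kv G v → omega G v j ≤ 2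
  omega≤2-below-kv 2≤n j 1≤j j<k with kv-spec (≤-trans (s≤s z≤n) 2≤n)
  ... | crowded _ _ sparse = sparse j 1≤j j<k
  ... | uncrowded k≡h sparse =
    sparse j 1≤j (≤-trans j<k (≤-trans (≤-reflexive k≡h) (≤-trans (m≤m+n _ _) (proj₁ (half-bounds n)))))

-- The extremal ball profile 1, 3, …, 2k − 1, 2k + 2, 2k + 4, …

extremalBall : ℕ → ℕ → ℕ
extremalBall k r with k ≤? r
... | yes _ = 2 + (r + r)
... | no _  = 1 + (r + r)

extremalBall-≥ : ∀ {k r} → k ≤ r → extremalBall k r ≡ 2 + (r + r)
extremalBall-≥ {k} {r} k≤r with k ≤? r
... | yes _   = refl
... | no k≰r = contradiction k≤r k≰r

extremalBall-< : ∀ {k r} → r < k → extremalBall k r ≡ 1 + (r + r)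
extremalBall-< {k} {r} r<k with k ≤? r
... | yes k≤r = contradiction k≤r (<⇒≱ r<k)
... | no _    = refl

1+2r≤extremalBall : ∀ k r → 1 + (r + r) ≤ extremalBall k r
1+2r≤extremalBall k r with k ≤? r
... | yes _ = n≤1+n _
... | no _  = ≤-refl

private
  c+[1+r+1+r]≡c+[r+r]+2 : ∀ c r → c + (suc r + suc r) ≡ c + (r + r) + 2
  c+[1+r+1+r]≡c+[r+r]+2 c r = begin
    c + (suc r + suc r)     ≡⟨ cong (c +_) (cong suc (+-suc r r)) ⟩
    c + suc (suc (r + r))   ≡⟨ +-suc c (suc (r + r)) ⟩
    suc (c + suc (r + r))   ≡⟨ cong suc (+-suc c (r + r)) ⟩
    2 + (c + (r + r))       ≡⟨ +-comm 2 _ ⟩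
    c + (r + r) + 2         ∎
    where open ≡-Reasoning

extremalBall-suc : ∀ k r → k ≢ suc r → extremalBall k (suc r) ≡ extremalBall k r + 2
extremalBall-suc k r k≢1+r with <-cmp k (suc r)
... | tri< (s≤s k≤r) _ _ = trans (extremalBall-≥ (m≤n⇒m≤1+n k≤r))
                                 (trans (c+[1+r+1+r]≡c+[r+r]+2 2 r) (cong (_+ 2) (sym (extremalBall-≥ k≤r))))
... | tri≈ _ k≡1+r _     = contradiction k≡1+r k≢1+r
... | tri> _ _ 1+r<k     = trans (extremalBall-< 1+r<k)
                                 (trans (c+[1+r+1+r]≡c+[r+r]+2 1 r) (cong (_+ 2) (sym (extremalBall-< (<-trans (n<1+n r) 1+r<k)))))

extremalBall-at : ∀ k r → k ≡ suc r → extremalBall k (suc r) ≡ extremalBall k r + 3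
extremalBall-at k r k≡1+r = begin
  extremalBall k (suc r)   ≡⟨ extremalBall-≥ (≤-reflexive k≡1+r) ⟩
  2 + (suc r + suc r)      ≡⟨ c+[1+r+1+r]≡c+[r+r]+2 2 r ⟩
  2 + (r + r) + 2          ≡⟨ cong suc (+-suc (r + r) 2) ⟨
  1 + (r + r) + 3          ≡⟨ cong (_+ 3) (extremalBall-< (subst (r <_) (sym k≡1+r) ≤-refl)) ⟨
  extremalBall k r + 3     ∎
  where open ≡-Reasoning

extremalBall-antitone : ∀ {a b} r → a ≤ b → extremalBall b r ≤ extremalBall a r
extremalBall-antitone {a} {b} r a≤b with b ≤? r
... | yes b≤r = ≤-reflexive (sym (extremalBall-≥ (≤-trans a≤b b≤r)))
... | no _    = 1+2r≤extremalBall a r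

extremalTransmission : ℕ → ℕ → ℕ
extremalTransmission n k = sumBelow n (λ r → n ∸ extremalBall k r)

extremalTransmission-mono : ∀ n {a b} → a ≤ b → extremalTransmission n a ≤ extremalTransmission n b
extremalTransmission-mono n a≤b = sumBelow-mono n (λ r _ → ∸-monoʳ-≤ n (extremalBall-antitone r a≤b))

extremalTransmission-strict : ∀ n {a b} → a < b → 2 + (a + a) ≤ n →
                              extremalTransmission n a < extremalTransmission n b
extremalTransmission-strict n {a} {b} a<b 2+2a≤n =
  sumBelow-strict n (λ r _ → ∸-monoʳ-≤ n (extremalBall-antitone r (<⇒≤ a<b)))
    (≤-trans (s≤s (≤-trans (m≤m+n a a) (n≤1+n _))) 2+2a≤n)
    (∸-monoʳ-< (≤-reflexive (trans (cong suc (extremalBall-< a<b)) (sym (extremalBall-≥ {a} ≤-refl))))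
               (≤-trans (≤-reflexive (extremalBall-≥ {a} ≤-refl)) 2+2a≤n))

module _ {n : ℕ} (G : Adj n) (v : Fin n) (G-2conn : TwoConnected G) where

  open ≤-Reasoning

  private
    k : ℕ
    k = kv G v
    2≤n : 2 ≤ n
    2≤n = ≤-trans (s≤s (s≤s z≤n)) (proj₁ G-2conn)
    2≤omega-next : ∀ r → ballSize G v (suc r) < n → 2 ≤ omega G v (suc r)
    2≤omega-next r ball<n = let y , 1+r<dy = ballSize<n⇒outside G v (suc r) ball<n
                            in twoConnected⇒omega≥2 G v G-2conn (suc r) y (s≤s z≤n) 1+r<dy

  -- Below the last level every level of a 2-connected graph has at least two vertices,
  -- and level k(v) has at least three.
  extremalBall-step : ∀ r → ballSize G v (suc r) < n → extremalBall k r ≤ ballSize G v r →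
                      extremalBall k (suc r) ≤ ballSize G v (suc r)
  extremalBall-step r ball<n e≤b with k ℕ.≟ suc r
  ... | no k≢1+r = begin
    extremalBall k (suc r)                ≡⟨ extremalBall-suc k r k≢1+r ⟩
    extremalBall k r + 2                  ≤⟨ +-mono-≤ e≤b (2≤omega-next r ball<n) ⟩
    ballSize G v r + omega G v (suc r)    ≡⟨ ballSize-suc G v r ⟨
    ballSize G v (suc r)                  ∎
  ... | yes k≡1+r = at-k (kv-spec G v (≤-trans (s≤s z≤n) 2≤n))
    where
    at-k : CrowdingIndex G v 1 n k → extremalBall k (suc r) ≤ ballSize G v (suc r)
    at-k (crowded _ 2<ω _) = begin
      extremalBall k (suc r)              ≡⟨ extremalBall-at k r k≡1+r ⟩
      extremalBall k r + 3                ≤⟨ +-mono-≤ e≤b (subst (λ j → 3 ≤ omega G v j) k≡1+r 2<ω) ⟩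
      ballSize G v r + omega G v (suc r)  ≡⟨ ballSize-suc G v r ⟨
      ballSize G v (suc r)                ∎
    at-k (uncrowded k≡h _) = contradiction (begin
      n                                   ≤⟨ proj₂ (half-bounds n) ⟩
      1 + (n / 2 + n / 2)                 ≡⟨ cong (λ h → 1 + (h + h)) (trans (sym k≡h) k≡1+r) ⟩
      1 + (suc r + suc r)                 ≡⟨ c+[1+r+1+r]≡c+[r+r]+2 1 r ⟩
      1 + (r + r) + 2                     ≡⟨ cong (_+ 2) (extremalBall-< (subst (r <_) (sym k≡1+r) ≤-refl)) ⟨
      extremalBall k r + 2                ≤⟨ +-mono-≤ e≤b (2≤omega-next r ball<n) ⟩
      ballSize G v r + omega G v (suc r)  ≡⟨ ballSize-suc G v r ⟨
      ballSize G v (suc r)                ∎) (<⇒≱ ball<n)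

  ballSize-≥-extremal : ∀ r → ballSize G v r ≡ n ⊎ extremalBall k r ≤ ballSize G v r
  ballSize-≥-extremal zero =
    inj₂ (≤-reflexive (trans (extremalBall-< (1≤kv G v 2≤n)) (sym (ballSize-zero G v))))
  ballSize-≥-extremal (suc r) with ballSize G v (suc r) ℕ.≟ n
  ... | yes full = inj₁ full
  ... | no ¬full = inj₂ (grow (ballSize-≥-extremal r))
    where
    ball<n : ballSize G v (suc r) < n
    ball<n = ≤∧≢⇒< (ballSize≤n G v (suc r)) ¬full
    grow : ballSize G v r ≡ n ⊎ extremalBall k r ≤ ballSize G v r → extremalBall k (suc r) ≤ ballSize G v (suc r)
    grow (inj₁ full) = contradiction (subst (_≤ ballSize G v (suc r)) full (ballSize≤ballSize-suc G v r)) (<⇒≱ ball<n)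
    grow (inj₂ e≤b)  = extremalBall-step r ball<n e≤b

  kv≡half⊎2+2kv≤n : kv G v ≡ n / 2 ⊎ 2 + (kv G v + kv G v) ≤ n
  kv≡half⊎2+2kv≤n with kv-spec G v (≤-trans (s≤s z≤n) 2≤n)
  ... | uncrowded k≡h _ = inj₁ k≡h
  ... | crowded 1≤k 2<ω _ = inj₂ (from-level-r (ballSize-≥-extremal r))
    where
    r : ℕ
    r = k ∸ 1
    k≡1+r : k ≡ suc r
    k≡1+r = sym (m+[n∸m]≡n 1≤k)
    3≤ω : 3 ≤ omega G v (suc r)
    3≤ω = subst (λ j → 3 ≤ omega G v j) k≡1+r 2<ω
    from-level-r : ballSize G v r ≡ n ⊎ extremalBall k r ≤ ballSize G v r → 2 + (k + k) ≤ n
    from-level-r (inj₁ full) = contradiction (begin-strict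
      n                                    ≡⟨ full ⟨
      ballSize G v r                       <⟨ m<m+n _ (≤-trans (s≤s z≤n) 3≤ω) ⟩
      ballSize G v r + omega G v (suc r)   ≡⟨ ballSize-suc G v r ⟨
      ballSize G v (suc r)                 ∎) (≤⇒≯ (ballSize≤n G v (suc r)))
    from-level-r (inj₂ e≤b) = begin
      2 + (k + k)                          ≡⟨ extremalBall-≥ {k} ≤-refl ⟨
      extremalBall k k                     ≡⟨ cong (extremalBall k) k≡1+r ⟩
      extremalBall k (suc r)               ≡⟨ extremalBall-at k r k≡1+r ⟩
      extremalBall k r + 3                 ≤⟨ +-mono-≤ e≤b 3≤ω ⟩
      ballSize G v r + omega G v (suc r)   ≡⟨ ballSize-suc G v r ⟨
      ballSize G v (suc r)                 ≤⟨ ballSize≤n G v (suc r) ⟩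
      n                                    ∎

  transmission≤extremal : transmission G v ≤ extremalTransmission n (kv G v)
  transmission≤extremal = begin
    transmission G v                          ≡⟨ transmission-by-balls G v ⟩
    sumBelow n (λ r → n ∸ ballSize G v r)    ≤⟨ sumBelow-mono n (λ r _ → co-bound r (ballSize-≥-extremal r)) ⟩
    extremalTransmission n k                  ∎
    where
    co-bound : ∀ r → ballSize G v r ≡ n ⊎ extremalBall k r ≤ ballSize G v r → n ∸ ballSize G v r ≤ n ∸ extremalBall k r
    co-bound r (inj₁ full) = ≤-trans (≤-reflexive (trans (cong (n ∸_) full) (n∸n≡0 n))) z≤n
    co-bound r (inj₂ e≤b)  = ∸-monoʳ-≤ n e≤b

kv≤half : ∀ {n} (H : Adj n) (v : Fin n) → 1 ≤ n → (∀ y → dist H v y ≤ n / 2) → kv H v ≤ n / 2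
kv≤half {n} H v 1≤n ecc≤h with kv-spec H v 1≤n
... | uncrowded k≡h _ = ≤-reflexive k≡h
... | crowded _ 2<ω _ =
  let y , dy≡k = count>0⇒∃ (λ x → dist H v x ℕ.≟ kv H v) (allFin n) (≤-trans (s≤s z≤n) 2<ω)
  in subst (_≤ n / 2) dy≡k (ecc≤h y)

module _ {n : ℕ} (H : Adj n) (v : Fin n) (2≤n : 2 ≤ n) (H-balls : ∀ r → ballSize H v r ≤ 2 + (r + r)) where

  ballSize≤extremal : ∀ r → ballSize H v r ≤ extremalBall (kv H v) r
  ballSize≤extremal r with ≤⊎> (kv H v) r
  ... | inj₁ k≤r = ≤-trans (H-balls r) (≤-reflexive (sym (extremalBall-≥ k≤r)))
  ... | inj₂ r<k = ≤-trans (below-k r r<k) (≤-reflexive (sym (extremalBall-< r<k)))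
    where
    open ≤-Reasoning
    below-k : ∀ r → r < kv H v → ballSize H v r ≤ 1 + (r + r)
    below-k zero    _     = ≤-reflexive (ballSize-zero H v)
    below-k (suc r) 1+r<k = begin
      ballSize H v (suc r)                ≡⟨ ballSize-suc H v r ⟩
      ballSize H v r + omega H v (suc r)  ≤⟨ +-mono-≤ (below-k r (<-trans (n<1+n r) 1+r<k))
                                                       (omega≤2-below-kv H v 2≤n (suc r) (s≤s z≤n) 1+r<k) ⟩
      1 + (r + r) + 2                     ≡⟨ c+[1+r+1+r]≡c+[r+r]+2 1 r ⟨
      1 + (suc r + suc r)                 ∎

  extremal≤transmission : extremalTransmission n (kv H v) ≤ transmission H v
  extremal≤transmission =
    ≤-trans (sumBelow-mono n (λ r _ → ∸-monoʳ-≤ n (ballSize≤extremal r))) (≤-reflexive (sym (transmission-by-balls H v)))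

-- Comparing Wiener indices through k-sequences

wiener-double : ∀ {n} (G : Adj n) → Symmetric G → wiener G + wiener G ≡ ∑ (transmission G)
wiener-double {n} G G-sym = begin
  wiener G + wiener G
    ≡⟨ cong₂ _+_ wiener≡ wiener≡ ⟩
  ∑ (λ u → ∑ (upper u)) + ∑ (λ u → ∑ (upper u))
    ≡⟨ cong (∑ (λ u → ∑ (upper u)) +_) (sum-map-swap upper (allFin n) (allFin n)) ⟩
  ∑ (λ u → ∑ (upper u)) + ∑ (λ u → ∑ (λ v → upper v u))
    ≡⟨ sum-map-+ _ _ (allFin n) ⟨
  ∑ (λ u → ∑ (upper u) + ∑ (λ v → upper v u))
    ≡⟨ sum-map-cong _ _ (allFin n) (λ u → sum-map-+ (upper u) (λ v → upper v u) (allFin n)) ⟨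
  ∑ (λ u → ∑ (λ v → upper u v + upper v u))
    ≡⟨ sum-map-cong _ _ (allFin n) (λ u → sum-map-cong _ _ (allFin n) (dist-split u)) ⟨
  ∑ (transmission G) ∎
  where
  open ≡-Reasoning
  upper : Fin n → Fin n → ℕ
  upper u v = if toℕ u <ᵇ toℕ v then dist G u v else 0
  wiener≡ : wiener G ≡ ∑ (λ u → ∑ (upper u))
  wiener≡ = trans (sum-concatMap _ (allFin n))
                  (sum-map-cong _ _ (allFin n) (λ u → sum-map-filter (λ v → toℕ u <? toℕ v) (dist G u) (allFin n)))
  dist-split : ∀ u v → dist G u v ≡ upper u v + upper v u
  dist-split u v with toℕ u <ᵇ toℕ v in e₁ | toℕ v <ᵇ toℕ u in e₂
  ... | true  | true  = contradiction (<ᵇ⇒< (toℕ u) (toℕ v) (subst T (sym e₁) tt))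
                                      (<⇒≯ (<ᵇ⇒< (toℕ v) (toℕ u) (subst T (sym e₂) tt)))
  ... | true  | false = sym (+-identityʳ _)
  ... | false | true  = dist-sym G G-sym u v
  ... | false | false with <-cmp (toℕ u) (toℕ v)
  ... | tri< u<v _ _ = contradiction (<⇒<ᵇ u<v) (subst T e₁)
  ... | tri> _ _ v<u = contradiction (<⇒<ᵇ v<u) (subst T e₂)
  ... | tri≈ _ u≡v _ = trans (cong (dist G u) (sym (toℕ-injective u≡v))) (dist-refl G u)

sum-map-sort : ∀ (h : ℕ → ℕ) xs → sum (map h (sort xs)) ≡ sum (map h xs)
sum-map-sort h xs = sum-↭ (map⁺ h (sort-↭ xs))

sum-map-≺ : ∀ (h : ℕ → ℕ) {P Q : ℕ → Set} → (∀ {a b} → a ≤ b → h a ≤ h b) →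
            (∀ {a b} → a < b → P a → Q b → h a < h b) →
            ∀ {xs ys} → xs ≺ ys → All P xs → All Q ys → sum (map h xs) < sum (map h ys)
sum-map-≺ h mono strict (a≤b ∷ xs⪯ys , here a<b)  (pa ∷ _)  (qb ∷ _)  = +-mono-<-≤ (strict a<b pa qb) (sum-map-⪯ xs⪯ys)
  where
  sum-map-⪯ : ∀ {xs ys} → xs ⪯ ys → sum (map h xs) ≤ sum (map h ys)
  sum-map-⪯ []             = z≤n
  sum-map-⪯ (a≤b ∷ xs⪯ys) = +-mono-≤ (mono a≤b) (sum-map-⪯ xs⪯ys)
sum-map-≺ h mono strict (a≤b ∷ xs⪯ys , there lt) (_ ∷ pxs) (_ ∷ qys) =
  +-mono-≤-< (mono a≤b) (sum-map-≺ h mono strict (xs⪯ys , lt) pxs qys)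

kSeq-≺⇒wiener-< : ∀ {n} (G H : Adj n) → Symmetric G → TwoConnected G → Symmetric H →
                  (∀ v r → ballSize H v r ≤ 2 + (r + r)) → (∀ v y → dist H v y ≤ n / 2) →
                  kSeq G ≺ kSeq H → wiener G < wiener H
kSeq-≺⇒wiener-< {n} G H G-sym G-2conn H-sym H-balls H-ecc kG≺kH = halve (begin-strict
  wiener G + wiener G
    ≡⟨ wiener-double G G-sym ⟩
  ∑ (transmission G)
    ≤⟨ sum-map-mono _ _ (allFin n) (λ v → transmission≤extremal G v G-2conn) ⟩
  ∑ (ET ∘ kv G)
    ≡⟨ sum-map-kSeq G ⟨
  sum (map ET (kSeq G))
    <⟨ sum-map-≺ ET (extremalTransmission-mono n) ET-strict kG≺kH
                 (sorted (λ v → kv≡half⊎2+2kv≤n G v G-2conn)) (sorted (λ v → kv≤half H v 1≤n (H-ecc v))) ⟩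
  sum (map ET (kSeq H))
    ≡⟨ sum-map-kSeq H ⟩
  ∑ (ET ∘ kv H)
    ≤⟨ sum-map-mono _ _ (allFin n) (λ v → extremal≤transmission H v 2≤n (H-balls v)) ⟩
  ∑ (transmission H)
    ≡⟨ wiener-double H H-sym ⟨
  wiener H + wiener H ∎)
  where
  open ≤-Reasoning
  ET : ℕ → ℕ
  ET = extremalTransmission n
  2≤n : 2 ≤ n
  2≤n = ≤-trans (s≤s (s≤s z≤n)) (proj₁ G-2conn)
  1≤n : 1 ≤ n
  1≤n = ≤-trans (s≤s z≤n) 2≤n
  sum-map-kSeq : ∀ G → sum (map ET (kSeq G)) ≡ ∑ (ET ∘ kv G)
  sum-map-kSeq G = trans (sum-map-sort ET (map (kv G) (allFin n))) (cong sum (sym (map-∘ {g = ET} {f = kv G} (allFin n))))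
  sorted : ∀ {P : ℕ → Set} {G} → (∀ v → P (kv G v)) → All P (kSeq G)
  sorted Pk = All-resp-↭ (↭-sym (sort-↭ _)) (All-map⁺ (universal Pk (allFin n)))
  ET-strict : ∀ {a b} → a < b → a ≡ n / 2 ⊎ 2 + (a + a) ≤ n → b ≤ n / 2 → ET a < ET b
  ET-strict a<b (inj₁ a≡h)    b≤h = contradiction (≤-trans b≤h (≤-reflexive (sym a≡h))) (<⇒≱ a<b)
  ET-strict a<b (inj₂ 2+2a≤n) _   = extremalTransmission-strict n a<b 2+2a≤n
  halve : wiener G + wiener G < wiener H + wiener H → wiener G < wiener H
  halve 2WG<2WH = ≰⇒> (λ WH≤WG → <⇒≱ 2WG<2WH (+-mono-≤ WH≤WG WH≤WG))

-- Distance on the cycle ℤ/L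

cycDist : ℕ → ℕ → ℕ → ℕ
cycDist L c p = ∣ c - p ∣ ⊓ (L ∸ ∣ c - p ∣)

cycDist≤L : ∀ L c p → cycDist L c p ≤ L
cycDist≤L L c p = ≤-trans (m⊓n≤n ∣ c - p ∣ _) (m∸n≤m L ∣ c - p ∣)

cycDist-refl : ∀ L c → cycDist L c c ≡ 0
cycDist-refl L c = cong (_⊓ (L ∸ ∣ c - c ∣)) (∣n-n∣≡0 c)

data CycleStep (L : ℕ) : ℕ → ℕ → Set where
  stay : ∀ {p} → CycleStep L p p
  next : ∀ {p} → CycleStep L p (suc p)
  wrap : ∀ {p} → suc p ≡ L → CycleStep L p 0

Adjacentᶜ : ℕ → ℕ → ℕ → Set
Adjacentᶜ L p q = CycleStep L p q ⊎ CycleStep L q p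

private
  suc-∸-≤ : ∀ m n → suc m ∸ n ≤ suc (m ∸ n)
  suc-∸-≤ m       zero    = ≤-refl
  suc-∸-≤ zero    (suc n) = ≤-trans (≤-reflexive (0∸n≡0 n)) z≤n
  suc-∸-≤ (suc m) (suc n) = suc-∸-≤ m n

  ∸-Lipschitz : ∀ L {a b} → b ≤ suc a → L ∸ a ≤ suc (L ∸ b)
  ∸-Lipschitz L {a} {b} b≤1+a = ≤-trans (∸-monoʳ-≤ (suc L) b≤1+a) (suc-∸-≤ L b)

  ∣p-1+p∣≡1 : ∀ p → ∣ p - suc p ∣ ≡ 1
  ∣p-1+p∣≡1 zero    = refl
  ∣p-1+p∣≡1 (suc p) = ∣p-1+p∣≡1 p

  ∣-∣-step : ∀ c p q → ∣ p - q ∣ ≡ 1 → ∣ c - q ∣ ≤ suc ∣ c - p ∣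
  ∣-∣-step c p q ∣p-q∣≡1 = ≤-trans (∣-∣-triangle c p q) (≤-reflexive (trans (cong (∣ c - p ∣ +_) ∣p-q∣≡1) (+-comm _ 1)))

  ⊓-swap-≤ : ∀ x y → x ⊓ suc y ≤ suc (y ⊓ suc x)
  ⊓-swap-≤ x y = ≤-trans (≤-reflexive (⊓-comm x (suc y))) (⊓-monoʳ-≤ (suc y) (≤-trans (n≤1+n x) (n≤1+n (suc x))))

cycDist-next : ∀ L c p → cycDist L c (suc p) ≤ suc (cycDist L c p) × cycDist L c p ≤ suc (cycDist L c (suc p))
cycDist-next L c p =
  ⊓-mono-≤ (∣-∣-step c p (suc p) (∣p-1+p∣≡1 p)) (∸-Lipschitz L (∣-∣-step c (suc p) p p↔1+p)) ,
  ⊓-mono-≤ (∣-∣-step c (suc p) p p↔1+p) (∸-Lipschitz L (∣-∣-step c p (suc p) (∣p-1+p∣≡1 p)))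
  where
  p↔1+p : ∣ suc p - p ∣ ≡ 1
  p↔1+p = trans (∣-∣-comm (suc p) p) (∣p-1+p∣≡1 p)

cycDist-wrap : ∀ L c p → c < L → suc p ≡ L → cycDist L c 0 ≤ suc (cycDist L c p) × cycDist L c p ≤ suc (cycDist L c 0)
cycDist-wrap L c p c<L refl = subst₂ (λ x y → x ≤ suc y × y ≤ suc x) (sym at-0) (sym at-p)
                                     (⊓-swap-≤ c (p ∸ c) , ⊓-swap-≤ (p ∸ c) c)
  where
  c≤p : c ≤ p
  c≤p = ≤-pred c<L
  at-0 : cycDist (suc p) c 0 ≡ c ⊓ suc (p ∸ c)
  at-0 = cong₂ _⊓_ (∣-∣-identityʳ c) (trans (cong (suc p ∸_) (∣-∣-identityʳ c)) (+-∸-assoc 1 c≤p))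
  at-p : cycDist (suc p) c p ≡ (p ∸ c) ⊓ suc c
  at-p = cong₂ _⊓_ (m≤n⇒∣m-n∣≡n∸m c≤p)
                   (trans (cong (suc p ∸_) (m≤n⇒∣m-n∣≡n∸m c≤p)) (trans (+-∸-assoc 1 (m∸n≤m p c)) (cong suc (m∸[m∸n]≡n c≤p))))

cycDist-step : ∀ {L c p q} → c < L → Adjacentᶜ L p q → cycDist L c q ≤ suc (cycDist L c p)
cycDist-step                 _   (inj₁ stay)         = n≤1+n _
cycDist-step {L} {c} {p}     _   (inj₁ next)         = proj₁ (cycDist-next L c p)
cycDist-step {L} {c} {p}     c<L (inj₁ (wrap 1+p≡L)) = proj₁ (cycDist-wrap L c p c<L 1+p≡L)
cycDist-step                 _   (inj₂ stay)         = n≤1+n _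
cycDist-step {L} {c} {q = q} _   (inj₂ next)         = proj₂ (cycDist-next L c q)
cycDist-step {L} {c} {q = q} c<L (inj₂ (wrap 1+q≡L)) = proj₂ (cycDist-wrap L c q c<L 1+q≡L)

private
  +-rearrange₁ : ∀ c w r d → c + w + (r + d) ≡ c + d + (r + w)
  +-rearrange₁ = solve-∀
  +-rearrange₂ : ∀ x w g → x + (w + g) ≡ (x + g) + w
  +-rearrange₂ = solve-∀
  +-rearrange₃ : ∀ p d w g → p + d + w + g ≡ p + ((d + g) + w)
  +-rearrange₃ = solve-∀
  +-rearrange₄ : ∀ p d w r x → p + d + w + (r + x) ≡ p + ((x + d) + ((r + w) + 0))
  +-rearrange₄ = solve-∀

-- Positions within cycle distance r of c: the 2r + 1 residues c − r, …, c + r.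
window : (L : ℕ) .{{_ : NonZero L}} → ℕ → ℕ → List ℕ
window L c r = map (λ t → (c + (L ∸ r) + t) % L) (upTo (suc (r + r)))

length-window : ∀ L .{{_ : NonZero L}} c r → length (window L c r) ≡ suc (r + r)
length-window L c r = trans (length-map _ (upTo (suc (r + r)))) (length-upTo (suc (r + r)))

private
  ∈window : ∀ L .{{_ : NonZero L}} c p r t k → p < L → t ≤ r + r → c + (L ∸ r) + t ≡ p + k * L → p ∈ window L c r
  ∈window L c p r t k p<L t≤2r c+w+t≡p+kL =
    subst (_∈ window L c r) residue (∈-map⁺ (λ t → (c + (L ∸ r) + t) % L) (∈-upTo⁺ (s≤s t≤2r)))
    where
    residue : (c + (L ∸ r) + t) % L ≡ p
    residue = trans (cong (_% L) c+w+t≡p+kL) (trans ([m+kn]%n≡m%n p k L) (m<n⇒m%n≡m p<L))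

  ⊓≤⇒⊎≤ : ∀ {a b r} → a ⊓ b ≤ r → a ≤ r ⊎ b ≤ r
  ⊓≤⇒⊎≤ {a} {b} {r} a⊓b≤r with ⊓-sel a b
  ... | inj₁ a⊓b≡a = inj₁ (subst (_≤ r) a⊓b≡a a⊓b≤r)
  ... | inj₂ a⊓b≡b = inj₂ (subst (_≤ r) a⊓b≡b a⊓b≤r)

  r+[L∸r]≡1*L : ∀ {L r} → r < L → r + (L ∸ r) ≡ 1 * L
  r+[L∸r]≡1*L {L} r<L = trans (m+[n∸m]≡n (<⇒≤ r<L)) (sym (+-identityʳ L))

∈window-ahead : ∀ L .{{_ : NonZero L}} c d r → c + d < L → r < L → cycDist L c (c + d) ≤ r → c + d ∈ window L c r
∈window-ahead L c d r c+d<L r<L cd≤r = [ short , long ]′ (⊓≤⇒⊎≤ (subst (λ x → x ⊓ (L ∸ x) ≤ r) (∣m-m+n∣≡n c d) cd≤r))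
  where
  open ≡-Reasoning
  short : d ≤ r → c + d ∈ window L c r
  short d≤r = ∈window L c (c + d) r (r + d) 1 c+d<L (+-monoʳ-≤ r d≤r) (begin
    c + (L ∸ r) + (r + d)  ≡⟨ +-rearrange₁ c (L ∸ r) r d ⟩
    c + d + (r + (L ∸ r))  ≡⟨ cong (c + d +_) (r+[L∸r]≡1*L r<L) ⟩
    c + d + 1 * L          ∎)
  long : L ∸ d ≤ r → c + d ∈ window L c r
  long L∸d≤r = let g , L∸d+g≡r = m≤n⇒∃[o]m+o≡n L∸d≤r in
    ∈window L c (c + d) r g 0 c+d<L (≤-trans (m≤n+m g _) (≤-trans (≤-reflexive L∸d+g≡r) (m≤m+n r r))) (begin
    c + (L ∸ r) + g        ≡⟨ +-assoc c (L ∸ r) g ⟩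
    c + ((L ∸ r) + g)      ≡⟨ cong (c +_) (+-cancelˡ-≡ (L ∸ d) _ d (begin
      L ∸ d + (L ∸ r + g)  ≡⟨ +-rearrange₂ (L ∸ d) (L ∸ r) g ⟩
      (L ∸ d + g) + (L ∸ r) ≡⟨ cong (_+ (L ∸ r)) L∸d+g≡r ⟩
      r + (L ∸ r)          ≡⟨ m+[n∸m]≡n (<⇒≤ r<L) ⟩
      L                    ≡⟨ m∸n+n≡m (<⇒≤ (≤-<-trans (m≤n+m d c) c+d<L)) ⟨
      L ∸ d + d            ∎)) ⟩
    c + d                  ≡⟨ +-identityʳ (c + d) ⟨
    c + d + 0 * L          ∎)

∈window-behind : ∀ L .{{_ : NonZero L}} p d r → p + d < L → r < L → cycDist L (p + d) p ≤ r → p ∈ window L (p + d) r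
∈window-behind L p d r p+d<L r<L cd≤r =
  [ short , long ]′ (⊓≤⇒⊎≤ (subst (λ x → x ⊓ (L ∸ x) ≤ r) (trans (∣-∣-comm (p + d) p) (∣m-m+n∣≡n p d)) cd≤r))
  where
  open ≡-Reasoning
  short : d ≤ r → p ∈ window L (p + d) r
  short d≤r = let g , d+g≡r = m≤n⇒∃[o]m+o≡n d≤r in
    ∈window L (p + d) p r g 1 (≤-<-trans (m≤m+n p d) p+d<L) (≤-trans (m≤n+m g d) (≤-trans (≤-reflexive d+g≡r) (m≤m+n r r))) (begin
    p + d + (L ∸ r) + g    ≡⟨ +-rearrange₃ p d (L ∸ r) g ⟩
    p + ((d + g) + (L ∸ r)) ≡⟨ cong (λ x → p + (x + (L ∸ r))) d+g≡r ⟩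
    p + (r + (L ∸ r))      ≡⟨ cong (p +_) (r+[L∸r]≡1*L r<L) ⟩
    p + 1 * L              ∎)
  long : L ∸ d ≤ r → p ∈ window L (p + d) r
  long L∸d≤r = ∈window L (p + d) p r (r + (L ∸ d)) 2 (≤-<-trans (m≤m+n p d) p+d<L) (+-monoʳ-≤ r L∸d≤r) (begin
    p + d + (L ∸ r) + (r + (L ∸ d))            ≡⟨ +-rearrange₄ p d (L ∸ r) r (L ∸ d) ⟩
    p + ((L ∸ d + d) + ((r + (L ∸ r)) + 0))    ≡⟨ cong₂ (λ x y → p + (x + (y + 0)))
                                                        (m∸n+n≡m (<⇒≤ (≤-<-trans (m≤n+m d p) p+d<L))) (m+[n∸m]≡n (<⇒≤ r<L)) ⟩
    p + 2 * L                                  ∎)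

cycDist≤⇒∈window : ∀ L .{{_ : NonZero L}} c p r → c < L → p < L → r < L → cycDist L c p ≤ r → p ∈ window L c r
cycDist≤⇒∈window L c p r c<L p<L r<L cd≤r with ≤-total c p
... | inj₁ c≤p = let d , c+d≡p = m≤n⇒∃[o]m+o≡n c≤p in
  subst (_∈ window L c r) c+d≡p
        (∈window-ahead L c d r (subst (_< L) (sym c+d≡p) p<L) r<L (subst (λ x → cycDist L c x ≤ r) (sym c+d≡p) cd≤r))
... | inj₂ p≤c = let d , p+d≡c = m≤n⇒∃[o]m+o≡n p≤c in
  subst (λ x → p ∈ window L x r) p+d≡c
        (∈window-behind L p d r (subst (_< L) (sym p+d≡c) c<L) r<L (subst (λ x → cycDist L x p ≤ r) (sym p+d≡c) cd≤r))

private
  +-rearrange₅ : ∀ a i b → a + (i + (1 + b)) ≡ suc (a + i + b)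
  +-rearrange₅ = solve-∀
  +-rearrange₆ : ∀ j b → (1 + j) + (1 + b) ≡ 2 + (j + b)
  +-rearrange₆ = solve-∀
  +-rearrange₇ : ∀ a b → (1 + a) + (1 + (1 + b)) ≡ 2 + (1 + (a + b))
  +-rearrange₇ = solve-∀

-- A cycle lab 0, …, lab L′ through all vertices but an apex, the apex being
-- joined to lab 0 and lab q

module CycleWithApex (L′ : ℕ) (lab : ℕ → ℕ) (apex q : ℕ) where

  data CycleEdge : ℕ → ℕ → Set where
    along : ∀ i → i < L′ → CycleEdge (lab i) (lab (suc i))
    close : CycleEdge (lab L′) (lab 0)
    apex₀ : CycleEdge apex (lab 0)
    apexq : CycleEdge apex (lab q)

  module Bounds
    (G : Adj (suc (suc L′))) (G-sym : Symmetric G)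
    (edge⁻ : ∀ u w → T (G u w) → CycleEdge (toℕ u) (toℕ w) ⊎ CycleEdge (toℕ w) (toℕ u))
    (edge⁺ : ∀ {a b} → CycleEdge a b → ∀ u w → toℕ u ≡ a → toℕ w ≡ b → T (G u w))
    (pos : ℕ → ℕ)
    (pos< : ∀ a → a < suc (suc L′) → pos a ≤ L′)
    (pos-lab : ∀ i → i ≤ L′ → pos (lab i) ≡ i)
    (lab-pos : ∀ a → a < suc (suc L′) → a ≢ apex → lab (pos a) ≡ a)
    (lab< : ∀ i → i ≤ L′ → lab i < suc (suc L′))
    (apex-adj₀ : Adjacentᶜ (suc L′) (pos apex) 0)
    (apex-adjq : Adjacentᶜ (suc L′) (pos apex) q)
    (1≤q : 1 ≤ q) (q≤L′ : q ≤ L′)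
    where

    private
      n L : ℕ
      n = suc (suc L′)
      L = suc L′

    cycleEdge-adjacent : ∀ {a b} → CycleEdge a b → Adjacentᶜ L (pos a) (pos b)
    cycleEdge-adjacent (along i i<L′) rewrite pos-lab i (<⇒≤ i<L′) | pos-lab (suc i) i<L′ = inj₁ next
    cycleEdge-adjacent close rewrite pos-lab L′ ≤-refl | pos-lab 0 z≤n = inj₁ (wrap refl)
    cycleEdge-adjacent apex₀ rewrite pos-lab 0 z≤n = apex-adj₀
    cycleEdge-adjacent apexq rewrite pos-lab q q≤L′ = apex-adjq

    edge-adjacent : ∀ u w → T (G u w) → Adjacentᶜ L (pos (toℕ u)) (pos (toℕ w))
    edge-adjacent u w uw = [ cycleEdge-adjacent , swap ∘ cycleEdge-adjacent ]′ (edge⁻ u w uw)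

    cycDist≤reach : ∀ k v y → T (reach G k v y) → cycDist L (pos (toℕ v)) (pos (toℕ y)) ≤ k
    cycDist≤reach zero v y v⇝y with reachW-zero G (λ _ → true) v y v⇝y
    ... | refl = ≤-reflexive (cycDist-refl L (pos (toℕ v)))
    cycDist≤reach (suc k) v y v⇝y with reach-split G k v y v⇝y
    ... | inj₁ v⇝y′ = m≤n⇒m≤1+n (cycDist≤reach k v y v⇝y′)
    ... | inj₂ (w , v⇝w , wy) =
      ≤-trans (cycDist-step (s≤s (pos< _ (toℕ<n v))) (edge-adjacent w y wy)) (s≤s (cycDist≤reach k v w v⇝w))

    cycDist≤dist : ∀ v y → cycDist L (pos (toℕ v)) (pos (toℕ y)) ≤ dist G v y
    cycDist≤dist v y = dist-≥ G v y _ (≤-trans (cycDist≤L L (pos (toℕ v)) (pos (toℕ y))) (n≤1+n L)) (λ k → cycDist≤reach k v y)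

    count-cycDist≤ : ∀ c r → c < L → r < L → count (λ y → cycDist L c (pos (toℕ y)) ≤? r) (allFin n) ≤ 2 + (r + r)
    count-cycDist≤ c r c<L r<L = begin
      count within? (allFin n)
        ≤⟨ count-≤-+ within? (λ y → toℕ y ℕ.≟ apex) off-apex? (λ {y} → split y) (allFin n) ⟩
      count (λ y → toℕ y ℕ.≟ apex) (allFin n) + count off-apex? (allFin n)
        ≤⟨ +-mono-≤ apex-once (count-injective≤length off-apex? (allFin n) (allFin⁺ n) (pos ∘ toℕ) injective (window L c r) in-window) ⟩
      1 + length (window L c r)
        ≡⟨ cong suc (length-window L c r) ⟩
      2 + (r + r) ∎
      where
      open ≤-Reasoning
      Within : Fin n → Set
      Within y = cycDist L c (pos (toℕ y)) ≤ r
      within? : ∀ y → Dec (Within y)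
      within? y = cycDist L c (pos (toℕ y)) ≤? r
      off-apex? : ∀ y → Dec (Within y × toℕ y ≢ apex)
      off-apex? y = within? y ×-dec ¬? (toℕ y ℕ.≟ apex)
      split : ∀ y → Within y → toℕ y ≡ apex ⊎ (Within y × toℕ y ≢ apex)
      split y within with toℕ y ℕ.≟ apex
      ... | yes y≡apex = inj₁ y≡apex
      ... | no y≢apex  = inj₂ (within , y≢apex)
      apex-once : count (λ y → toℕ y ℕ.≟ apex) (allFin n) ≤ 1
      apex-once = count≤1 (λ y → toℕ y ℕ.≟ apex) (allFin n) (allFin⁺ n) (λ x≡a y≡a → toℕ-injective (trans x≡a (sym y≡a)))
      injective : ∀ {x y} → Within x × toℕ x ≢ apex → Within y × toℕ y ≢ apex → pos (toℕ x) ≡ pos (toℕ y) → x ≡ y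
      injective {x} {y} (_ , x≢a) (_ , y≢a) px≡py = toℕ-injective (begin-equality
        toℕ x              ≡⟨ lab-pos (toℕ x) (toℕ<n x) x≢a ⟨
        lab (pos (toℕ x))  ≡⟨ cong lab px≡py ⟩
        lab (pos (toℕ y))  ≡⟨ lab-pos (toℕ y) (toℕ<n y) y≢a ⟩
        toℕ y              ∎)
      in-window : ∀ {y} → Within y × toℕ y ≢ apex → pos (toℕ y) ∈ window L c r
      in-window {y} (within , _) = cycDist≤⇒∈window L c (pos (toℕ y)) r c<L (s≤s (pos< _ (toℕ<n y))) r<L within

    ballSize≤2+2r : ∀ v r → ballSize G v r ≤ 2 + (r + r)
    ballSize≤2+2r v r with r <? L
    ... | no r≮L  = ≤-trans (ballSize≤n G v r) (s≤s (≤-trans (≮⇒≥ r≮L) (≤-trans (m≤m+n r r) (n≤1+n _))))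
    ... | yes r<L = ≤-trans (count-mono (λ y → dist G v y ≤? r) (λ y → cycDist L c (pos (toℕ y)) ≤? r)
                                        (≤-trans (cycDist≤dist v _)) (allFin n))
                            (count-cycDist≤ c r (s≤s (pos< _ (toℕ<n v))) r<L)
      where
      c : ℕ
      c = pos (toℕ v)

    record LabelWalk (k a b : ℕ) : Set where
      constructor walk
      field run : ∀ u w → toℕ u ≡ a → toℕ w ≡ b → T (reach G k u w)
    open LabelWalk

    walk-refl : ∀ {a} → LabelWalk 0 a a
    walk-refl = walk λ u w u≡a w≡a → subst (λ z → T (reach G 0 u z)) (toℕ-injective (trans u≡a (sym w≡a))) (reach-refl G u)

    walk-sym : ∀ {k a b} → LabelWalk k a b → LabelWalk k b a
    walk-sym {k} p = walk λ u w u≡b w≡a → reach-sym G G-sym k w u (run p w u w≡a u≡b)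

    walk-edge : ∀ {a b} → CycleEdge a b → LabelWalk 1 a b
    walk-edge e = walk λ u w u≡a w≡b → reach-step G 0 u u w (reach-refl G u) (edge⁺ e u w u≡a w≡b)

    walk-++ : ∀ {k l a b c} → b < n → LabelWalk k a b → LabelWalk l b c → LabelWalk (k + l) a c
    walk-++ {k} {l} b<n p q = walk λ u w u≡a w≡c →
      reach-trans G k l u (fromℕ< b<n) w (run p u _ u≡a (toℕ-fromℕ< b<n)) (run q _ w (toℕ-fromℕ< b<n) w≡c)

    walk-∷ʳ : ∀ {k a b c} → b < n → LabelWalk k a b → CycleEdge b c → LabelWalk (suc k) a c
    walk-∷ʳ {k} b<n p e = walk λ u w u≡a w≡c →
      reach-step G k u (fromℕ< b<n) w (run p u _ u≡a (toℕ-fromℕ< b<n)) (edge⁺ e _ w (toℕ-fromℕ< b<n) w≡c)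

    along-walk : ∀ t i → t + i ≤ L′ → LabelWalk t (lab i) (lab (t + i))
    along-walk zero    i _        = walk-refl
    along-walk (suc t) i 1+t+i≤L′ =
      walk-∷ʳ (lab< (t + i) (≤-trans (n≤1+n _) 1+t+i≤L′)) (along-walk t i (≤-trans (n≤1+n _) 1+t+i≤L′)) (along (t + i) 1+t+i≤L′)

    between : ∀ i j → i ≤ j → j ≤ L′ → LabelWalk (j ∸ i) (lab i) (lab j)
    between i j i≤j j≤L′ = subst (λ x → LabelWalk (j ∸ i) (lab i) (lab x)) (m∸n+n≡m i≤j)
                                 (along-walk (j ∸ i) i (≤-trans (≤-reflexive (m∸n+n≡m i≤j)) j≤L′))

    Near : ℕ → ℕ → Set
    Near a b = ∃[ k ] (k ≤ n / 2 × LabelWalk k a b)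

    classify : ∀ a → a < n → a ≡ apex ⊎ ∃[ i ] (i ≤ L′ × lab i ≡ a)
    classify a a<n with a ℕ.≟ apex
    ... | yes a≡apex = inj₁ a≡apex
    ... | no a≢apex  = inj₂ (pos a , pos< a a<n , lab-pos a a<n a≢apex)

    near-sym : ∀ {a b} → Near a b → Near b a
    near-sym (k , k≤h , p) = k , k≤h , walk-sym p

    near-of-two : ∀ {x y a b} → LabelWalk x a b → LabelWalk y a b → x + y ≤ n → Near a b
    near-of-two {x} {y} p q x+y≤n with x ≤? n / 2 | y ≤? n / 2
    ... | yes x≤h | _       = x , x≤h , p
    ... | no _    | yes y≤h = y , y≤h , q
    ... | no x≰h  | no y≰h  = contradiction x+y≤n (<⇒≱ (begin-strict
      n                        ≤⟨ proj₂ (half-bounds n) ⟩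
      suc (n / 2 + n / 2)      <⟨ ≤-reflexive (cong suc (sym (+-suc (n / 2) (n / 2)))) ⟩
      suc (n / 2) + suc (n / 2) ≤⟨ +-mono-≤ (≰⇒> x≰h) (≰⇒> y≰h) ⟩
      x + y                    ∎))
      where open ≤-Reasoning

    cycle-near : ∀ i j → i ≤ j → j ≤ L′ → Near (lab i) (lab j)
    cycle-near i j i≤j j≤L′ = near-of-two (between i j i≤j j≤L′) around (≤-trans (≤-reflexive (begin-equality
      (j ∸ i) + (i + (1 + (L′ ∸ j)))  ≡⟨ +-rearrange₅ (j ∸ i) i (L′ ∸ j) ⟩
      suc ((j ∸ i) + i + (L′ ∸ j))    ≡⟨ cong (λ x → suc (x + (L′ ∸ j))) (m∸n+n≡m i≤j) ⟩
      suc (j + (L′ ∸ j))              ≡⟨ cong suc (m+[n∸m]≡n j≤L′) ⟩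
      suc L′                          ∎)) (n≤1+n _))
      where
      open ≤-Reasoning
      around : LabelWalk (i + (1 + (L′ ∸ j))) (lab i) (lab j)
      around = walk-++ (lab< 0 z≤n) (walk-sym (between 0 i z≤n (≤-trans i≤j j≤L′)))
                 (walk-++ (lab< L′ ≤-refl) (walk-sym (walk-edge close)) (walk-sym (between j L′ j≤L′ ≤-refl)))

    apex-near : ∀ j → j ≤ L′ → Near apex (lab j)
    apex-near j j≤L′ with ≤-total j q
    ... | inj₁ j≤q = near-of-two (walk-++ (lab< 0 z≤n) (walk-edge apex₀) (between 0 j z≤n j≤L′))
                                 (walk-++ (lab< q q≤L′) (walk-edge apexq) (walk-sym (between j q j≤q q≤L′)))
                                 (begin
      (1 + j) + (1 + (q ∸ j))     ≡⟨ +-rearrange₆ j (q ∸ j) ⟩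
      2 + (j + (q ∸ j))           ≡⟨ cong (2 +_) (m+[n∸m]≡n j≤q) ⟩
      2 + q                       ≤⟨ +-monoʳ-≤ 2 q≤L′ ⟩
      n                           ∎)
      where open ≤-Reasoning
    ... | inj₂ q≤j = near-of-two (walk-++ (lab< q q≤L′) (walk-edge apexq) (between q j q≤j j≤L′))
                                 (walk-++ (lab< 0 z≤n) (walk-edge apex₀)
                                   (walk-++ (lab< L′ ≤-refl) (walk-sym (walk-edge close)) (walk-sym (between j L′ j≤L′ ≤-refl))))
                                 (begin
      (1 + (j ∸ q)) + (1 + (1 + (L′ ∸ j)))  ≡⟨ +-rearrange₇ (j ∸ q) (L′ ∸ j) ⟩
      2 + (1 + ((j ∸ q) + (L′ ∸ j)))        ≤⟨ +-monoʳ-≤ 2 (+-monoˡ-≤ _ 1≤q) ⟩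
      2 + (q + ((j ∸ q) + (L′ ∸ j)))        ≡⟨ cong (2 +_) (+-assoc q (j ∸ q) (L′ ∸ j)) ⟨
      2 + (q + (j ∸ q) + (L′ ∸ j))          ≡⟨ cong (λ x → 2 + (x + (L′ ∸ j))) (m+[n∸m]≡n q≤j) ⟩
      2 + (j + (L′ ∸ j))                    ≡⟨ cong (2 +_) (m+[n∸m]≡n j≤L′) ⟩
      n                                     ∎)
      where open ≤-Reasoning

    near : ∀ a b → a < n → b < n → Near a b
    near a b a<n b<n with classify a a<n | classify b b<n
    ... | inj₁ refl              | inj₁ refl              = 0 , z≤n , walk-refl
    ... | inj₁ refl              | inj₂ (j , j≤L′ , refl) = apex-near j j≤L′
    ... | inj₂ (i , i≤L′ , refl) | inj₁ refl              = near-sym (apex-near i i≤L′)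
    ... | inj₂ (i , i≤L′ , refl) | inj₂ (j , j≤L′ , refl) with ≤-total i j
    ...   | inj₁ i≤j = cycle-near i j i≤j j≤L′
    ...   | inj₂ j≤i = near-sym (cycle-near j i j≤i i≤L′)

    dist≤half : ∀ u w → dist G u w ≤ suc (suc L′) / 2
    dist≤half u w with near (toℕ u) (toℕ w) (toℕ<n u) (toℕ<n w)
    ... | k , k≤h , p = ≤-trans (dist-minimal G u w k (run p u w refl refl)) k≤h

any-cong : ∀ {A : Set} {f g : A → Bool} → (∀ x → f x ≡ g x) → ∀ xs → any f xs ≡ any g xs
any-cong f≡g []       = refl
any-cong f≡g (x ∷ xs) = cong₂ _∨_ (f≡g x) (any-cong f≡g xs)

H-sym : ∀ n p q → Symmetric (H n p q)
H-sym n p q u v = any-cong (λ (a , b) → ∨-comm ((a ≡ᵇ toℕ u) ∧ (b ≡ᵇ toℕ v)) ((a ≡ᵇ toℕ v) ∧ (b ≡ᵇ toℕ u))) (hEdges n p q)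

H-edge⁻ : ∀ n p q (u v : Fin n) → T (H n p q u v) →
          (toℕ u , toℕ v) ∈ hEdges n p q ⊎ (toℕ v , toℕ u) ∈ hEdges n p q
H-edge⁻ n p q u v uv with find (any⁻ _ (hEdges n p q) uv)
... | (a , b) , ab∈E , match with to T-∨ match
... | inj₁ forward with to T-∧ forward
...   | a≡u , b≡v = inj₁ (subst₂ (λ x y → (x , y) ∈ hEdges n p q) (≡ᵇ⇒≡ a _ a≡u) (≡ᵇ⇒≡ b _ b≡v) ab∈E)
H-edge⁻ n p q u v uv | (a , b) , ab∈E , match | inj₂ backward with to T-∧ backward
...   | a≡v , b≡u = inj₂ (subst₂ (λ x y → (x , y) ∈ hEdges n p q) (≡ᵇ⇒≡ a _ a≡v) (≡ᵇ⇒≡ b _ b≡u) ab∈E)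

H-edge⁺ : ∀ n p q (u v : Fin n) → (toℕ u , toℕ v) ∈ hEdges n p q ⊎ (toℕ v , toℕ u) ∈ hEdges n p q →
          T (H n p q u v)
H-edge⁺ n p q u v uv∈E⊎vu∈E = any⁺ matches (either uv∈E⊎vu∈E)
  where
  matches : ℕ × ℕ → Bool
  matches (a , b) = ((a ≡ᵇ toℕ u) ∧ (b ≡ᵇ toℕ v)) ∨ ((a ≡ᵇ toℕ v) ∧ (b ≡ᵇ toℕ u))
  u≡ᵇu : T (toℕ u ≡ᵇ toℕ u)
  u≡ᵇu = ≡⇒≡ᵇ (toℕ u) (toℕ u) refl
  v≡ᵇv : T (toℕ v ≡ᵇ toℕ v)
  v≡ᵇv = ≡⇒≡ᵇ (toℕ v) (toℕ v) refl
  either : (toℕ u , toℕ v) ∈ hEdges n p q ⊎ (toℕ v , toℕ u) ∈ hEdges n p q → Any (T ∘ matches) (hEdges n p q)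
  either (inj₁ uv∈E) = lose uv∈E (from T-∨ (inj₁ (from T-∧ (u≡ᵇu , v≡ᵇv))))
  either (inj₂ vu∈E) = lose vu∈E (from T-∨ (inj₂ (from T-∧ (v≡ᵇv , u≡ᵇu))))

-- The edges of the path x, s, s + 1, …, s + c − 1, 1 (just x, 1 when c = 0).
data PathEdge (x s c : ℕ) : ℕ → ℕ → Set where
  direct : c ≡ 0 → PathEdge x s c x 1
  first  : 0 < c → PathEdge x s c x s
  step   : ∀ a → s ≤ a → suc a < s + c → PathEdge x s c a (suc a)
  last   : ∀ a → 0 < c → suc a ≡ s + c → PathEdge x s c a 1

∈-path⁻ : ∀ x s c {a b} → (a , b) ∈ consec (x ∷ range s c ++ 1 ∷ []) → PathEdge x s c a b
∈-path⁻ x s zero    (here refl) = direct refl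
∈-path⁻ x s (suc c) (here refl) = first (s≤s z≤n)
∈-path⁻ x s (suc c) (there ab∈P) with ∈-path⁻ s (suc s) c ab∈P
... | direct refl          = last s (s≤s z≤n) (+-comm 1 s)
... | first 0<c            = step s ≤-refl (subst (suc (suc s) ≤_) (sym (+-suc s c)) (s≤s (≤-trans (≤-reflexive (+-comm 1 s)) (+-monoʳ-≤ s 0<c))))
... | step a 1+s≤a 1+a<    = step a (≤-trans (n≤1+n s) 1+s≤a) (subst (suc a <_) (sym (+-suc s c)) 1+a<)
... | last a 0<c 1+a≡      = last a (s≤s z≤n) (trans 1+a≡ (sym (+-suc s c)))

∈-path⁺ : ∀ x s c {a b} → PathEdge x s c a b → (a , b) ∈ consec (x ∷ range s c ++ 1 ∷ [])
∈-path⁺ x s zero    (direct _)  = here refl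
∈-path⁺ x s zero    (first ())
∈-path⁺ x s zero    (step a s≤a 1+a<s+0) = contradiction 1+a<s+0 (≤⇒≯ (≤-trans (≤-reflexive (+-identityʳ s)) (≤-trans s≤a (n≤1+n a))))
∈-path⁺ x s zero    (last a () _)
∈-path⁺ x s (suc c) (direct ())
∈-path⁺ x s (suc c) (first _)   = here refl
∈-path⁺ x s (suc c) (step a s≤a 1+a<) with m≤n⇒m<n∨m≡n s≤a
... | inj₁ s<a  = there (∈-path⁺ s (suc s) c (step a s<a (subst (suc a <_) (+-suc s c) 1+a<)))
... | inj₂ refl with c
...   | zero    = contradiction 1+a< (≤⇒≯ (≤-reflexive (+-comm a 1)))
...   | suc c′  = there (∈-path⁺ s (suc s) (suc c′) (first (s≤s z≤n)))
∈-path⁺ x s (suc c) (last a _ 1+a≡s+1+c) with c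
... | zero   = there (∈-path⁺ s (suc s) 0 (subst (λ y → PathEdge s (suc s) 0 y 1) (suc-injective (trans (+-comm 1 s) (sym 1+a≡s+1+c))) (direct refl)))
... | suc c′ = there (∈-path⁺ s (suc s) (suc c′) (last a (s≤s z≤n) (trans 1+a≡s+1+c (+-suc s (suc c′)))))

module _ (n p q : ℕ) {R : ℕ → ℕ → Set} where

  H-edge-as⁻ : (∀ {a b} → (a , b) ∈ hEdges n p q → R a b ⊎ R b a) →
               ∀ u w → T (H n p q u w) → R (toℕ u) (toℕ w) ⊎ R (toℕ w) (toℕ u)
  H-edge-as⁻ toR u w uw = [ toR , swap ∘ toR ]′ (H-edge⁻ n p q u w uw)

  H-edge-as⁺ : (∀ {a b} → R a b → (a , b) ∈ hEdges n p q ⊎ (b , a) ∈ hEdges n p q) →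
               ∀ {a b} → R a b → ∀ u w → toℕ u ≡ a → toℕ w ≡ b → T (H n p q u w)
  H-edge-as⁺ fromR r u w u≡a w≡b =
    H-edge⁺ n p q u w (subst₂ (λ x y → (x , y) ∈ hEdges n p q ⊎ (y , x) ∈ hEdges n p q) (sym u≡a) (sym w≡b) (fromR r))

-- H_{n,1,2} is the cycle 1, 0, 3, 4, …, n − 1 plus the apex 2 joined to 1 and 0

module H₁₂ (m : ℕ) where

  lab : ℕ → ℕ
  lab 0             = 1
  lab 1             = 0
  lab (suc (suc i)) = 3 + i

  pos : ℕ → ℕ
  pos 0                   = 1
  pos 1                   = 0
  pos 2                   = 0
  pos (suc (suc (suc a))) = 2 + a

  -- Sizes are spelled in the successor form that matching on 5 ≤ n produces in lemma3; with
  -- any other spelling, checking lemma3 unfolds ballSize and dist and takes minutes.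
  open CycleWithApex (suc (suc (suc m))) lab 2 1

  private
    P₁ P₂ : List (ℕ × ℕ)
    P₁ = pathEdges (range 2 0)
    P₂ = pathEdges (range 2 1)

  hEdge⇒cycleEdge : ∀ {a b} → (a , b) ∈ hEdges (5 + m) 1 2 → CycleEdge a b ⊎ CycleEdge b a
  hEdge⇒cycleEdge ab∈E with ∈-++⁻ P₁ ab∈E
  ... | inj₁ ab∈P₁ with ∈-path⁻ 0 2 0 ab∈P₁
  ...   | direct _ = inj₂ (along 0 (s≤s z≤n))
  ...   | step a 2≤a 1+a<2 = contradiction 1+a<2 (≤⇒≯ (m≤n⇒m≤1+n 2≤a))
  hEdge⇒cycleEdge ab∈E | inj₂ ab∈E′ with ∈-++⁻ P₂ ab∈E′
  ... | inj₁ ab∈P₂ with ∈-path⁻ 0 2 1 ab∈P₂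
  ...   | first _ = inj₂ apexq
  ...   | last _ _ refl = inj₁ apex₀
  ...   | step a 2≤a 1+a<3 = contradiction 1+a<3 (≤⇒≯ (s≤s 2≤a))
  hEdge⇒cycleEdge ab∈E | inj₂ ab∈E′ | inj₂ ab∈P₃ with ∈-path⁻ 0 3 (2 + m) ab∈P₃
  ... | first _ = inj₁ (along 1 (s≤s (s≤s z≤n)))
  ... | step (suc (suc (suc b))) _ (s≤s (s≤s (s≤s (s≤s (s≤s b≤m))))) = inj₁ (along (2 + b) (s≤s (s≤s (s≤s b≤m))))
  ... | step 0 () _
  ... | step 1 (s≤s ()) _
  ... | step 2 (s≤s (s≤s ())) _
  ... | last _ _ refl = inj₁ close

  cycleEdge⇒hEdge : ∀ {a b} → CycleEdge a b → (a , b) ∈ hEdges (5 + m) 1 2 ⊎ (b , a) ∈ hEdges (5 + m) 1 2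
  cycleEdge⇒hEdge (along 0 _)                   = inj₂ (∈-++⁺ˡ (∈-path⁺ 0 2 0 (direct refl)))
  cycleEdge⇒hEdge (along 1 _)                   = inj₁ (∈-++⁺ʳ P₁ (∈-++⁺ʳ P₂ (∈-path⁺ 0 3 (2 + m) (first (s≤s z≤n)))))
  cycleEdge⇒hEdge (along (suc (suc i)) 2+i<L′)  =
    inj₁ (∈-++⁺ʳ P₁ (∈-++⁺ʳ P₂ (∈-path⁺ 0 3 (2 + m) (step (3 + i) (s≤s (s≤s (s≤s z≤n))) (s≤s (s≤s 2+i<L′))))))
  cycleEdge⇒hEdge close = inj₁ (∈-++⁺ʳ P₁ (∈-++⁺ʳ P₂ (∈-path⁺ 0 3 (2 + m) (last (4 + m) (s≤s z≤n) refl))))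
  cycleEdge⇒hEdge apex₀ = inj₁ (∈-++⁺ʳ P₁ (∈-++⁺ˡ (∈-path⁺ 0 2 1 (last 2 (s≤s z≤n) refl))))
  cycleEdge⇒hEdge apexq = inj₂ (∈-++⁺ʳ P₁ (∈-++⁺ˡ (∈-path⁺ 0 2 1 (first (s≤s z≤n)))))

  pos< : ∀ a → a < 5 + m → pos a ≤ 3 + m
  pos< 0 _ = s≤s z≤n
  pos< 1 _ = z≤n
  pos< 2 _ = z≤n
  pos< (suc (suc (suc a))) (s≤s (s≤s (s≤s a<2+m))) = s≤s (s≤s (≤-pred a<2+m))

  pos-lab : ∀ i → i ≤ 3 + m → pos (lab i) ≡ i
  pos-lab 0 _             = refl
  pos-lab 1 _             = refl
  pos-lab (suc (suc i)) _ = refl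

  lab-pos : ∀ a → a < 5 + m → a ≢ 2 → lab (pos a) ≡ a
  lab-pos 0 _ _                   = refl
  lab-pos 1 _ _                   = refl
  lab-pos 2 _ a≢2                 = contradiction refl a≢2
  lab-pos (suc (suc (suc a))) _ _ = refl

  lab< : ∀ i → i ≤ 3 + m → lab i < 5 + m
  lab< 0 _ = s≤s (s≤s z≤n)
  lab< 1 _ = s≤s z≤n
  lab< (suc (suc i)) (s≤s (s≤s i≤1+m)) = s≤s (s≤s (s≤s (s≤s i≤1+m)))

  open Bounds (H (suc (suc (suc (suc (suc m))))) 1 2) (H-sym (suc (suc (suc (suc (suc m))))) 1 2)
              (H-edge-as⁻ (5 + m) 1 2 hEdge⇒cycleEdge) (H-edge-as⁺ (5 + m) 1 2 cycleEdge⇒hEdge)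
              pos pos< pos-lab lab-pos lab< (inj₁ stay) (inj₁ next) ≤-refl (s≤s z≤n)
    public using (ballSize≤2+2r; dist≤half)

-- H_{n,2,2} is the cycle 1, 2, 0, 4, 5, …, n − 1 plus the apex 3 joined to 1 and 0

module H₂₂ (m : ℕ) where

  lab : ℕ → ℕ
  lab 0                   = 1
  lab 1                   = 2
  lab 2                   = 0
  lab (suc (suc (suc i))) = 4 + i

  pos : ℕ → ℕ
  pos 0                         = 2
  pos 1                         = 0
  pos 2                         = 1
  pos 3                         = 1
  pos (suc (suc (suc (suc a)))) = 3 + a

  open CycleWithApex (suc (suc (suc m))) lab 3 2

  private
    P₁ P₂ : List (ℕ × ℕ)
    P₁ = pathEdges (range 2 1)
    P₂ = pathEdges (range 3 1)

  hEdge⇒cycleEdge : ∀ {a b} → (a , b) ∈ hEdges (5 + m) 2 2 → CycleEdge a b ⊎ CycleEdge b a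
  hEdge⇒cycleEdge ab∈E with ∈-++⁻ P₁ ab∈E
  ... | inj₁ ab∈P₁ with ∈-path⁻ 0 2 1 ab∈P₁
  ...   | first _          = inj₂ (along 1 (s≤s (s≤s z≤n)))
  ...   | last _ _ refl    = inj₂ (along 0 (s≤s z≤n))
  ...   | step a 2≤a 1+a<3 = contradiction 1+a<3 (≤⇒≯ (s≤s 2≤a))
  hEdge⇒cycleEdge ab∈E | inj₂ ab∈E′ with ∈-++⁻ P₂ ab∈E′
  ... | inj₁ ab∈P₂ with ∈-path⁻ 0 3 1 ab∈P₂
  ...   | first _          = inj₂ apexq
  ...   | last _ _ refl    = inj₁ apex₀
  ...   | step a 3≤a 1+a<4 = contradiction 1+a<4 (≤⇒≯ (s≤s 3≤a))
  hEdge⇒cycleEdge ab∈E | inj₂ ab∈E′ | inj₂ ab∈P₃ with ∈-path⁻ 0 4 (1 + m) ab∈P₃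
  ... | first _ = inj₁ (along 2 (s≤s (s≤s (s≤s z≤n))))
  ... | step (suc (suc (suc (suc b)))) _ (s≤s (s≤s (s≤s (s≤s (s≤s 1+b≤m))))) = inj₁ (along (3 + b) (s≤s (s≤s (s≤s 1+b≤m))))
  ... | step 0 () _
  ... | step 1 (s≤s ()) _
  ... | step 2 (s≤s (s≤s ())) _
  ... | step 3 (s≤s (s≤s (s≤s ()))) _
  ... | last _ _ refl = inj₁ close

  cycleEdge⇒hEdge : ∀ {a b} → CycleEdge a b → (a , b) ∈ hEdges (5 + m) 2 2 ⊎ (b , a) ∈ hEdges (5 + m) 2 2
  cycleEdge⇒hEdge (along 0 _) = inj₂ (∈-++⁺ˡ (∈-path⁺ 0 2 1 (last 2 (s≤s z≤n) refl)))
  cycleEdge⇒hEdge (along 1 _) = inj₂ (∈-++⁺ˡ (∈-path⁺ 0 2 1 (first (s≤s z≤n))))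
  cycleEdge⇒hEdge (along 2 _) = inj₁ (∈-++⁺ʳ P₁ (∈-++⁺ʳ P₂ (∈-path⁺ 0 4 (1 + m) (first (s≤s z≤n)))))
  cycleEdge⇒hEdge (along (suc (suc (suc i))) 3+i<L′) =
    inj₁ (∈-++⁺ʳ P₁ (∈-++⁺ʳ P₂ (∈-path⁺ 0 4 (1 + m) (step (4 + i) (s≤s (s≤s (s≤s (s≤s z≤n)))) (s≤s (s≤s 3+i<L′))))))
  cycleEdge⇒hEdge close = inj₁ (∈-++⁺ʳ P₁ (∈-++⁺ʳ P₂ (∈-path⁺ 0 4 (1 + m) (last (4 + m) (s≤s z≤n) refl))))
  cycleEdge⇒hEdge apex₀ = inj₁ (∈-++⁺ʳ P₁ (∈-++⁺ˡ (∈-path⁺ 0 3 1 (last 3 (s≤s z≤n) refl))))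
  cycleEdge⇒hEdge apexq = inj₂ (∈-++⁺ʳ P₁ (∈-++⁺ˡ (∈-path⁺ 0 3 1 (first (s≤s z≤n)))))

  pos< : ∀ a → a < 5 + m → pos a ≤ 3 + m
  pos< 0 _ = s≤s (s≤s z≤n)
  pos< 1 _ = z≤n
  pos< 2 _ = s≤s z≤n
  pos< 3 _ = s≤s z≤n
  pos< (suc (suc (suc (suc a)))) (s≤s (s≤s (s≤s (s≤s a<1+m)))) = s≤s (s≤s (s≤s (≤-pred a<1+m)))

  pos-lab : ∀ i → i ≤ 3 + m → pos (lab i) ≡ i
  pos-lab 0 _                   = refl
  pos-lab 1 _                   = refl
  pos-lab 2 _                   = refl
  pos-lab (suc (suc (suc i))) _ = refl

  lab-pos : ∀ a → a < 5 + m → a ≢ 3 → lab (pos a) ≡ a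
  lab-pos 0 _ _                         = refl
  lab-pos 1 _ _                         = refl
  lab-pos 2 _ _                         = refl
  lab-pos 3 _ a≢3                       = contradiction refl a≢3
  lab-pos (suc (suc (suc (suc a)))) _ _ = refl

  lab< : ∀ i → i ≤ 3 + m → lab i < 5 + m
  lab< 0 _ = s≤s (s≤s z≤n)
  lab< 1 _ = s≤s (s≤s (s≤s z≤n))
  lab< 2 _ = s≤s z≤n
  lab< (suc (suc (suc i))) (s≤s (s≤s (s≤s i≤m))) = s≤s (s≤s (s≤s (s≤s (s≤s i≤m))))

  open Bounds (H (suc (suc (suc (suc (suc m))))) 2 2) (H-sym (suc (suc (suc (suc (suc m))))) 2 2)
              (H-edge-as⁻ (5 + m) 2 2 hEdge⇒cycleEdge) (H-edge-as⁺ (5 + m) 2 2 cycleEdge⇒hEdge)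
              pos pos< pos-lab lab-pos lab< (inj₂ next) (inj₁ next) (s≤s z≤n) (s≤s (s≤s z≤n))
    public using (ballSize≤2+2r; dist≤half)

lemma3 : ∀ (n : ℕ) (G : Adj n) → Symmetric G → Irreflexive G →
    TwoConnected G → 5 ≤ n →
    ((kSeq G ≺ kSeq (H n 1 2) → wiener G Data.Nat.< wiener (H n 1 2)) ×
    (kSeq G ≺ kSeq (H n 2 2) → wiener G Data.Nat.< wiener (H n 2 2)))
lemma3 n G G-sym _ G-2conn (s≤s (s≤s (s≤s (s≤s (s≤s {n = m} z≤n))))) =
  kSeq-≺⇒wiener-< G (H n 1 2) G-sym G-2conn (H-sym n 1 2) (H₁₂.ballSize≤2+2r m) (H₁₂.dist≤half m) ,
  kSeq-≺⇒wiener-< G (H n 2 2) G-sym G-2conn (H-sym n 2 2) (H₂₂.ballSize≤2+2r m) (H₂₂.dist≤half m)
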